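{- Let $T=(V,E)$ be a tree with root $r$ and maximum degree $\Delta$, and let $T_H=(V_H,H)$, $H\subseteq E$, be a connected subtree of $T$ containing $r$. Let $q\ge\Delta+1$, and let $\mu$ and $\nu$ be the uniform distributions on proper $q$-edge-colorings of $T$ and of $T_H$, respectively. If $\mu$ satisfies approximate edge-tensorization of variance with constant $C$, then $\nu$ satisfies approximate edge-tensorization of variance with constant $C(q+1)^2$.
   Context: A proper $q$-edge-coloring assigns colors from $[q]$ to edges with edges sharing an endpoint receiving distinct colors. For a distribution $\pi$ on $\Omega\subseteq[q]^E$, $S\subseteq E$, $f:\Omega\to\mathbb{R}$, $\sigma\in\Omega$: $\mathrm{Var}_S[f](\sigma)$ is the variance of $f$ under $\pi$ conditioned on agreeing with $\sigma$ outside $S$, and $\pi[\cdot]$ denotes expectation under $\pi$. For a tree with edge set $E$, let $\mathcal{P}$ be the collection of all singletons $\{e\}$, $e\in E$, and all pairs $\{e,e'\}$ of adjacent edges. $\pi$ satisfies approximate edge-tensorization with constant $C$ if for every $f:\Omega(\pi)\to\mathbb{R}$, $\mathrm{Var}_\pi[f]\le C\sum_{S\in\mathcal{P}}\pi[\mathrm{Var}_S[f]]$.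
   Formalization: In approximate edge-tensorization, for both μ and ν, the constant $C$ is rational and the functions $f$ take values in ℚ instead of ℝ. -}

module Defs where

open import Data.Nat using (ℕ; zero; suc) renaming (_⊔_ to _⊔ℕ_)
open import Data.Fin using (Fin; zero; suc; toℕ; _<_) renaming (_≟_ to _≟F_)
open import Data.Fin.Properties using () renaming (_<?_ to _<?F_)
open import Data.Maybe using (Maybe; just; nothing)
open import Data.Maybe.Properties using () renaming (≡-dec to ≡-decM)
open import Data.Bool using (Bool; true; false; _∧_; _∨_; not; if_then_else_)
open import Data.List using (List; []; _∷_; map; concatMap; foldr; length; allFin; filterᵇ)
open import Data.Integer using (+_)
open import Data.Rational using (ℚ; 0ℚ; _+_; _*_; _-_; _/_; _≤_)
open import Relation.Nullary.Decidable using (⌊_⌋)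
open import Relation.Binary.PropositionalEquality using (_≡_)

-- Rooted trees.  A rooted tree with n edges has vertex set Fin (suc n),
-- root zero; vertex (suc i) has parent  par i  with smaller index.
-- Edge i is the edge {suc i , par i}.

record RootedTree (n : ℕ) : Set where
  field
    par     : Fin n → Fin (suc n)
    par-lt  : ∀ i → toℕ (par i) Data.Nat.≤ toℕ i

open RootedTree public

endpointᵇ : ∀ {n} → RootedTree n → Fin (suc n) → Fin n → Bool
endpointᵇ T v i = ⌊ v ≟F suc i ⌋ ∨ ⌊ v ≟F par T i ⌋

adjᵇ : ∀ {n} → RootedTree n → Fin n → Fin n → Bool
adjᵇ T i j = not ⌊ i ≟F j ⌋ ∧
  ( ⌊ suc i ≟F suc j ⌋ ∨ ⌊ suc i ≟F par T j ⌋
  ∨ ⌊ par T i ≟F suc j ⌋ ∨ ⌊ par T i ≟F par T j ⌋ )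

degree : ∀ {n} → RootedTree n → Fin (suc n) → ℕ
degree {n} T v = length (filterᵇ (endpointᵇ T v) (allFin n))

maxDegree : ∀ {n} → RootedTree n → ℕ
maxDegree {n} T = foldr _⊔ℕ_ 0 (map (degree T) (allFin (suc n)))

-- A set H of edges (as a predicate) spans a connected subtree containing
-- the root iff it is closed under taking the parent edge.
RootedSubtree : ∀ {n} → RootedTree n → (Fin n → Bool) → Set
RootedSubtree {n} T H =
  ∀ (i j : Fin n) → H i ≡ true → par T i ≡ suc j → H j ≡ true

-- Edge colourings of the edge set {e | inE e ≡ true} ⊆ Fin n.
-- A colouring assigns  just c  to edges in the set, nothing elsewhere.

allᵇ : ∀ {A : Set} → (A → Bool) → List A → Bool
allᵇ p = foldr (λ x b → p x ∧ b) true

Colouring : ℕ → ℕ → Set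
Colouring n q = Fin n → Maybe (Fin q)

consF : ∀ {n} {A : Set} → A → (Fin n → A) → Fin (suc n) → A
consF a g zero    = a
consF a g (suc i) = g i

choices : ∀ {A : Set} (n : ℕ) → (Fin n → List A) → List (Fin n → A)
choices zero    opts = (λ ()) ∷ []
choices (suc n) opts =
  concatMap (λ a → map (consF a) (choices n (λ i → opts (suc i)))) (opts zero)

allColourings : ∀ {n} (q : ℕ) → (Fin n → Bool) → List (Colouring n q)
allColourings {n} q inE =
  choices n (λ e → if inE e then map just (allFin q) else (nothing ∷ []))

eqColᵇ : ∀ {q} → Maybe (Fin q) → Maybe (Fin q) → Bool
eqColᵇ a b = ⌊ ≡-decM _≟F_ a b ⌋

properᵇ : ∀ {n q} → (Fin n → Bool) → (Fin n → Fin n → Bool) → Colouring n q → Bool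
properᵇ {n} inE adj c =
  allᵇ (λ e → allᵇ (λ e' →
    not (inE e ∧ inE e' ∧ adj e e') ∨ not (eqColᵇ (c e) (c e')))
    (allFin n)) (allFin n)

-- Ω : the proper q-edge-colourings of the edge set inE (support of the
-- uniform distribution π)
Ω : ∀ {n} (q : ℕ) → (Fin n → Bool) → (Fin n → Fin n → Bool) → List (Colouring n q)
Ω q inE adj = filterᵇ (properᵇ inE adj) (allColourings q inE)

sumℚ : List ℚ → ℚ
sumℚ = foldr _+_ 0ℚ

invℕ : ℕ → ℚ
invℕ zero    = 0ℚ
invℕ (suc k) = + 1 / suc k

avg : List ℚ → ℚ
avg xs = sumℚ xs * invℕ (length xs)

variance : List ℚ → ℚ
variance xs = avg (map (λ x → (x - m) * (x - m)) xs)
  where m = avg xs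

agreeOutsideᵇ : ∀ {n q} → (Fin n → Bool) → Colouring n q → Colouring n q → Bool
agreeOutsideᵇ {n} S σ τ = allᵇ (λ e → S e ∨ eqColᵇ (σ e) (τ e)) (allFin n)

module _ {n q : ℕ} (inE : Fin n → Bool) (adj : Fin n → Fin n → Bool) where

  Var : (Colouring n q → ℚ) → ℚ
  Var f = variance (map f (Ω q inE adj))

  -- Var_S[f](σ) : variance of f under π conditioned on agreeing with σ off S
  VarS : (Fin n → Bool) → (Colouring n q → ℚ) → Colouring n q → ℚ
  VarS S f σ = variance (map f (filterᵇ (agreeOutsideᵇ S σ) (Ω q inE adj)))

  Exp : (Colouring n q → ℚ) → ℚ
  Exp g = avg (map g (Ω q inE adj))

  singleton : Fin n → Fin n → Bool
  singleton e x = ⌊ x ≟F e ⌋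

  pair : Fin n → Fin n → Fin n → Bool
  pair e e' x = ⌊ x ≟F e ⌋ ∨ ⌊ x ≟F e' ⌋

  𝒫 : List (Fin n → Bool)
  𝒫 = map singleton (filterᵇ inE (allFin n))
      Data.List.++
      concatMap (λ e → map (pair e)
        (filterᵇ (λ e' → inE e ∧ inE e' ∧ adj e e' ∧ ⌊ e <?F e' ⌋) (allFin n)))
        (allFin n)

  EdgeTensorization : ℚ → Set
  EdgeTensorization C =
    ∀ (f : Colouring n q → ℚ) →
      Var f ≤ C * sumℚ (map (λ S → Exp (VarS S f)) 𝒫)

allEdges : ∀ {n} → Fin n → Bool
allEdges _ = true

{-# OPTIONS --safe #-}
-- Every proper colouring of the subtree on H extends to the same number K ≥ 1 of proper colourings
-- of T: adding the remaining edges parent first, a new edge meets the already coloured edges only at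
-- its parent end, where they carry distinct colours, so it has exactly q minus their number ≥ 1
-- choices, independently of the colouring. Hence restriction to H pushes μ forward to ν, so for f on
-- Ω(ν) the pullback g = f ∘ restrict has Var_μ g = Var_ν f, while μ conditions on more colours than ν,
-- which can only decrease expected conditional variances: μ[Var_S g] ≤ ν[Var_S f]. Finally ν[Var_S f]
-- depends only on S ∩ H, and the sum of these over the blocks S of T is at most 1 + 4Δ ≤ (q + 1)²
-- times the sum over the blocks of the subtree.
module Submission where

open import Algebra.Bundles using (Ring)
open import Data.Bool using (Bool; true; false; if_then_else_; _∧_; _∨_; not; T?)
import Data.Bool.Properties as BoolP
open import Data.Empty using (⊥-elim)
open import Data.Fin as Fin using (Fin; zero; suc; toℕ)
import Data.Fin.Properties as FinP
import Data.Integer as ℤ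
import Data.Integer.Properties as ℤP
open import Data.List using (List; []; _∷_; map; foldr; length; filterᵇ; _++_; concatMap; allFin; head)
open import Data.List.Membership.Propositional using (_∈_; find)
open import Data.List.Membership.Propositional.Properties
  using (∈-filter⁻; ∈-filter⁺; ∈-allFin; ∈-map⁻; ∈-map⁺; ∈-concatMap⁻)
open import Data.List.Properties using (length-map; map-∘; length-++; filter-++; map-tabulate; length-tabulate)
import Data.List.Relation.Unary.All as All
open import Data.List.Relation.Unary.Any using (here; there)
open import Data.List.Relation.Unary.Unique.Propositional using (Unique; []; _∷_)
import Data.List.Relation.Unary.Unique.Propositional.Properties as Unique
open import Data.Maybe using (Maybe; just; nothing; fromMaybe)
import Data.Maybe.Properties as Maybe
open import Data.Nat as ℕ using (ℕ; zero; suc; z≤n; s≤s)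
import Data.Nat.Coprimality as Coprime
import Data.Nat.Properties as ℕP
open import Data.Nat.Tactic.RingSolver using (solve-∀)
open import Data.Product using (∃-syntax; _×_; _,_; proj₁; proj₂)
open import Data.Rational using (ℚ; 0ℚ; 1ℚ; _+_; _*_; _-_; -_; _/_; _≤_; mkℚ; 1/_; nonNegative)
import Data.Rational.Properties as ℚP
open import Data.Rational.Solver using (module +-*-Solver)
open import Data.Sum using (_⊎_; inj₁; inj₂)
open import Function using (_∘_; id; Equivalence)
open import Relation.Binary.PropositionalEquality
open import Relation.Binary.Structures using (IsEquivalence)
open import Relation.Nullary using (¬_; Dec)
open import Relation.Nullary.Decidable using (⌊_⌋; isYes≗does; dec-true; dec-false; toWitness)

open import Algebra.Properties.Group ℚP.+-0-group using (∙-cancelˡ)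
import Algebra.Properties.Semiring.Mult (Ring.semiring ℚP.+-*-ring) as Mult
open +-*-Solver

open import Defs

fromℕ : ℕ → ℚ
fromℕ k = k Mult.× 1ℚ

fromℕ-+ : ∀ a b → fromℕ (a ℕ.+ b) ≡ fromℕ a + fromℕ b
fromℕ-+ a b = Mult.×-homo-+ 1ℚ a b

fromℕ-* : ∀ a b → fromℕ (a ℕ.* b) ≡ fromℕ a * fromℕ b
fromℕ-* = Mult.×1-homo-*

*-nonneg : ∀ {a b} → 0ℚ ≤ a → 0ℚ ≤ b → 0ℚ ≤ a * b
*-nonneg {a} {b} 0≤a 0≤b =
  ℚP.nonNegative⁻¹ (a * b) {{ℚP.nonNeg*nonNeg⇒nonNeg a {{nonNegative 0≤a}} b {{nonNegative 0≤b}}}}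

*-monoʳ-≤-nonneg : ∀ {a x y} → 0ℚ ≤ a → x ≤ y → x * a ≤ y * a
*-monoʳ-≤-nonneg {a} 0≤a = ℚP.*-monoʳ-≤-nonNeg a {{nonNegative 0≤a}}

*-monoˡ-≤-nonneg : ∀ {a x y} → 0ℚ ≤ a → x ≤ y → a * x ≤ a * y
*-monoˡ-≤-nonneg {a} 0≤a = ℚP.*-monoˡ-≤-nonNeg a {{nonNegative 0≤a}}

infix 8 _²
_² : ℚ → ℚ
x ² = x * x

square-nonneg : ∀ x → 0ℚ ≤ x ²
square-nonneg x with ℚP.≤-total 0ℚ x
... | inj₁ 0≤x = *-nonneg 0≤x 0≤x
... | inj₂ x≤0 = ℚP.≤-trans (*-nonneg 0≤-x 0≤-x) (ℚP.≤-reflexive (solve 1 (λ x → (:- x) :* (:- x) := x :* x) refl x))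
  where
  0≤-x : 0ℚ ≤ - x
  0≤-x = ℚP.neg-antimono-≤ x≤0

≤-+-nonneg : ∀ {a b} → 0ℚ ≤ b → a ≤ a + b
≤-+-nonneg {a} 0≤b = ℚP.≤-trans (ℚP.≤-reflexive (sym (ℚP.+-identityʳ a))) (ℚP.+-monoʳ-≤ a 0≤b)

fromℕ-nonneg : ∀ k → 0ℚ ≤ fromℕ k
fromℕ-nonneg zero    = ℚP.≤-refl
fromℕ-nonneg (suc k) = ℚP.+-mono-≤ (ℚP.<⇒≤ (ℚP.positive⁻¹ 1ℚ)) (fromℕ-nonneg k)

fromℕ-suc-pos : ∀ k → 0ℚ Data.Rational.< fromℕ (suc k)
fromℕ-suc-pos k = ℚP.+-mono-<-≤ (ℚP.positive⁻¹ 1ℚ) (fromℕ-nonneg k)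

fromℕ-mono : ∀ {a b} → a ℕ.≤ b → fromℕ a ≤ fromℕ b
fromℕ-mono {a} {b} a≤b = begin
  fromℕ a                   ≤⟨ ≤-+-nonneg (fromℕ-nonneg (b ℕ.∸ a)) ⟩
  fromℕ a + fromℕ (b ℕ.∸ a) ≡⟨ sym (fromℕ-+ a (b ℕ.∸ a)) ⟩
  fromℕ (a ℕ.+ (b ℕ.∸ a))   ≡⟨ cong fromℕ (ℕP.m+[n∸m]≡n a≤b) ⟩
  fromℕ b                   ∎
  where open ℚP.≤-Reasoning

fromℕ-injective : ∀ {a b} → fromℕ a ≡ fromℕ b → a ≡ b
fromℕ-injective {zero}  {zero}  _  = refl
fromℕ-injective {zero}  {suc b} eq = ⊥-elim (ℚP.<-irrefl eq (fromℕ-suc-pos b))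
fromℕ-injective {suc a} {zero}  eq = ⊥-elim (ℚP.<-irrefl (sym eq) (fromℕ-suc-pos a))
fromℕ-injective {suc a} {suc b} eq = cong suc (fromℕ-injective (∙-cancelˡ 1ℚ (fromℕ a) (fromℕ b) eq))

/1-normal : ∀ k → ℤ.+ k / 1 ≡ mkℚ (ℤ.+ k) 0 (Coprime.sym (Coprime.1-coprimeTo k))
/1-normal k = ℚP.normalize-coprime (Coprime.sym (Coprime.1-coprimeTo k))

fromℕ≡/1 : ∀ k → fromℕ k ≡ ℤ.+ k / 1
fromℕ≡/1 zero    = refl
fromℕ≡/1 (suc k) = begin
  1ℚ + fromℕ k                                              ≡⟨ cong (_+_ 1ℚ) (trans (fromℕ≡/1 k) (/1-normal k)) ⟩
  1ℚ + mkℚ (ℤ.+ k) 0 (Coprime.sym (Coprime.1-coprimeTo k))  ≡⟨ ℚP./-cong numerator refl ⟩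
  ℤ.+ suc k / 1                                             ∎
  where
  open ≡-Reasoning
  numerator : ℤ.+ 1 ℤ.+ ℤ.+ k ℤ.* ℤ.+ 1 ≡ ℤ.+ suc k
  numerator = cong (ℤ._+_ (ℤ.+ 1)) (ℤP.*-identityʳ (ℤ.+ k))

invℕ-inverse : ∀ k → invℕ (suc k) * fromℕ (suc k) ≡ 1ℚ
invℕ-inverse k = trans (cong₂ _*_ inv≡ (trans (fromℕ≡/1 (suc k)) (/1-normal (suc k)))) (ℚP.*-inverseˡ p)
  where
  p : ℚ
  p = mkℚ (ℤ.+ suc k) 0 (Coprime.sym (Coprime.1-coprimeTo (suc k)))
  inv≡ : invℕ (suc k) ≡ 1/ p
  inv≡ = ℚP.normalize-coprime (Coprime.1-coprimeTo (suc k))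

invℕ-nonneg : ∀ k → 0ℚ ≤ invℕ k
invℕ-nonneg zero    = ℚP.≤-refl
invℕ-nonneg (suc k) = ℚP.nonNegative⁻¹ (invℕ (suc k)) {{ℚP.normalize-nonNeg 1 (suc k)}}

invℕ-* : ∀ a b → invℕ (a ℕ.* b) ≡ invℕ a * invℕ b
invℕ-* zero    b = sym (ℚP.*-zeroˡ (invℕ b))
invℕ-* (suc a) zero rewrite ℕP.*-zeroʳ a = sym (ℚP.*-zeroʳ (invℕ (suc a)))
invℕ-* (suc a) (suc b) = begin
  u                ≡⟨ sym (ℚP.*-identityʳ u) ⟩
  u * 1ℚ           ≡⟨ cong (u *_) (sym v*p≡1) ⟩
  u * (v * p)      ≡⟨ solve 3 (λ u v p → u :* (v :* p) := v :* (u :* p)) refl u v p ⟩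
  v * (u * p)      ≡⟨ cong (v *_) u*p≡1 ⟩
  v * 1ℚ           ≡⟨ ℚP.*-identityʳ v ⟩
  v                ∎
  where
  open ≡-Reasoning
  u v p : ℚ
  u = invℕ (suc a ℕ.* suc b)
  v = invℕ (suc a) * invℕ (suc b)
  p = fromℕ (suc a) * fromℕ (suc b)
  u*p≡1 : u * p ≡ 1ℚ
  u*p≡1 = trans (cong (u *_) (sym (fromℕ-* (suc a) (suc b)))) (invℕ-inverse (b ℕ.+ a ℕ.* suc b))
  v*p≡1 : v * p ≡ 1ℚ
  v*p≡1 = trans (solve 4 (λ i j m n → (i :* j) :* (m :* n) := (i :* m) :* (j :* n)) refl
                          (invℕ (suc a)) (invℕ (suc b)) (fromℕ (suc a)) (fromℕ (suc b)))
                (cong₂ _*_ (invℕ-inverse a) (invℕ-inverse b))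

-- C may be negative: for C ≤ 0 the last hypothesis makes both sides vanish.
scaled-bound : ∀ {V A B C k : ℚ} → 0ℚ ≤ A → 0ℚ ≤ B →
               V ≤ C * A → A ≤ k * B → (V ≤ 0ℚ → B ≤ 0ℚ) → V ≤ (C * k) * B
scaled-bound {V} {A} {B} {C} {k} 0≤A 0≤B V≤CA A≤kB V≤0⇒B≤0 with ℚP.≤-total 0ℚ C
... | inj₁ 0≤C = ℚP.≤-trans V≤CA
                   (ℚP.≤-trans (*-monoˡ-≤-nonneg 0≤C A≤kB) (ℚP.≤-reflexive (sym (ℚP.*-assoc C k B))))
... | inj₂ C≤0 = ℚP.≤-trans V≤0
                   (ℚP.≤-reflexive (sym (trans (cong ((C * k) *_) B≡0) (ℚP.*-zeroʳ (C * k)))))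
  where
  V≤0 : V ≤ 0ℚ
  V≤0 = ℚP.≤-trans V≤CA (ℚP.≤-trans (*-monoʳ-≤-nonneg 0≤A C≤0) (ℚP.≤-reflexive (ℚP.*-zeroˡ A)))
  B≡0 : B ≡ 0ℚ
  B≡0 = ℚP.≤-antisym (V≤0⇒B≤0 V≤0) 0≤B

1+4Δ≤[1+q]² : ∀ {Δ q} → suc Δ ℕ.≤ q → suc ((Δ ℕ.+ Δ) ℕ.+ (Δ ℕ.+ Δ)) ℕ.≤ suc q ℕ.* suc q
1+4Δ≤[1+q]² {Δ} {q} Δ<q = begin
  suc ((Δ ℕ.+ Δ) ℕ.+ (Δ ℕ.+ Δ))                          ≤⟨ ℕP.m≤m+n _ (3 ℕ.+ Δ ℕ.* Δ) ⟩
  suc ((Δ ℕ.+ Δ) ℕ.+ (Δ ℕ.+ Δ)) ℕ.+ (3 ℕ.+ Δ ℕ.* Δ)       ≡⟨ expand Δ ⟩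
  suc (suc Δ) ℕ.* suc (suc Δ)                            ≤⟨ ℕP.*-mono-≤ (s≤s Δ<q) (s≤s Δ<q) ⟩
  suc q ℕ.* suc q                                        ∎
  where
  open ℕP.≤-Reasoning
  expand : ∀ d → suc ((d ℕ.+ d) ℕ.+ (d ℕ.+ d)) ℕ.+ (3 ℕ.+ d ℕ.* d) ≡ suc (suc d) ℕ.* suc (suc d)
  expand = solve-∀

bool-ext : ∀ {a b : Bool} → (a ≡ true → b ≡ true) → (b ≡ true → a ≡ true) → a ≡ b
bool-ext {false} {false} _   _   = refl
bool-ext {false} {true}  _   b⇒a = b⇒a refl
bool-ext {true}  {false} a⇒b _   = sym (a⇒b refl)
bool-ext {true}  {true}  _   _   = refl

module _ {P : Set} (p? : Dec P) where

  ⌊⌋-true : P → ⌊ p? ⌋ ≡ true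
  ⌊⌋-true p = trans (isYes≗does p?) (dec-true p? p)

  ⌊⌋-false : ¬ P → ⌊ p? ⌋ ≡ false
  ⌊⌋-false ¬p = trans (isYes≗does p?) (dec-false p? ¬p)

  ⌊⌋-sound : ⌊ p? ⌋ ≡ true → P
  ⌊⌋-sound eq = toWitness (Equivalence.from BoolP.T-≡ eq)

∨-elim : ∀ {a b : Bool} → a ∨ b ≡ true → a ≡ true ⊎ b ≡ true
∨-elim {true}  _  = inj₁ refl
∨-elim {false} eq = inj₂ eq

∨-introˡ : ∀ {a} b → a ≡ true → a ∨ b ≡ true
∨-introˡ b refl = refl

∨-introʳ : ∀ a {b} → b ≡ true → a ∨ b ≡ true
∨-introʳ true  _  = refl
∨-introʳ false eq = eq

∧-intro : ∀ {a b : Bool} → a ≡ true → b ≡ true → a ∧ b ≡ true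
∧-intro refl refl = refl

∑ : {A : Set} → List A → (A → ℚ) → ℚ
∑ L φ = sumℚ (map φ L)

count : {A : Set} → (A → Bool) → List A → ℕ
count p L = length (filterᵇ p L)

module _ {A : Set} where

  ∑-cong : (L : List A) {φ ψ : A → ℚ} → (∀ x → x ∈ L → φ x ≡ ψ x) → ∑ L φ ≡ ∑ L ψ
  ∑-cong []      eq = refl
  ∑-cong (x ∷ L) eq = cong₂ _+_ (eq x (here refl)) (∑-cong L (λ y y∈L → eq y (there y∈L)))

  ∑-+ : (L : List A) (φ ψ : A → ℚ) → ∑ L (λ x → φ x + ψ x) ≡ ∑ L φ + ∑ L ψ
  ∑-+ []      φ ψ = refl
  ∑-+ (x ∷ L) φ ψ = trans (cong (φ x + ψ x +_) (∑-+ L φ ψ))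
    (solve 4 (λ a b c d → a :+ b :+ (c :+ d) := a :+ c :+ (b :+ d)) refl (φ x) (ψ x) (∑ L φ) (∑ L ψ))

  ∑-*ˡ : (L : List A) (a : ℚ) (φ : A → ℚ) → ∑ L (λ x → a * φ x) ≡ a * ∑ L φ
  ∑-*ˡ []      a φ = sym (ℚP.*-zeroʳ a)
  ∑-*ˡ (x ∷ L) a φ = trans (cong (a * φ x +_) (∑-*ˡ L a φ)) (sym (ℚP.*-distribˡ-+ a (φ x) (∑ L φ)))

  ∑-*ʳ : (L : List A) (a : ℚ) (φ : A → ℚ) → ∑ L (λ x → φ x * a) ≡ ∑ L φ * a
  ∑-*ʳ L a φ = begin
    ∑ L (λ x → φ x * a) ≡⟨ ∑-cong L (λ x _ → ℚP.*-comm (φ x) a) ⟩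
    ∑ L (λ x → a * φ x) ≡⟨ ∑-*ˡ L a φ ⟩
    a * ∑ L φ           ≡⟨ ℚP.*-comm a (∑ L φ) ⟩
    ∑ L φ * a           ∎
    where open ≡-Reasoning

  ∑-zero : (L : List A) → ∑ L (λ _ → 0ℚ) ≡ 0ℚ
  ∑-zero []      = refl
  ∑-zero (x ∷ L) = trans (ℚP.+-identityˡ _) (∑-zero L)

  ∑-const : (L : List A) (a : ℚ) → ∑ L (λ _ → a) ≡ fromℕ (length L) * a
  ∑-const []      a = sym (ℚP.*-zeroˡ a)
  ∑-const (x ∷ L) a = trans (cong (a +_) (∑-const L a))
    (solve 2 (λ a n → a :+ n :* a := (con 1ℚ :+ n) :* a) refl a (fromℕ (length L)))

  ∑-filterᵇ : (L : List A) (p : A → Bool) (φ : A → ℚ) →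
              ∑ (filterᵇ p L) φ ≡ ∑ L (λ x → if p x then φ x else 0ℚ)
  ∑-filterᵇ []      p φ = refl
  ∑-filterᵇ (x ∷ L) p φ with p x
  ... | true  = cong (φ x +_) (∑-filterᵇ L p φ)
  ... | false = trans (∑-filterᵇ L p φ) (sym (ℚP.+-identityˡ _))

  ∑-count : (L : List A) (p : A → Bool) (a : ℚ) →
            ∑ L (λ x → if p x then a else 0ℚ) ≡ fromℕ (count p L) * a
  ∑-count L p a = trans (sym (∑-filterᵇ L p (λ _ → a))) (∑-const (filterᵇ p L) a)

  fromℕ-count : (L : List A) (p : A → Bool) → fromℕ (count p L) ≡ ∑ L (λ x → if p x then 1ℚ else 0ℚ)
  fromℕ-count L p = sym (trans (∑-count L p 1ℚ) (ℚP.*-identityʳ _))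

  ∑-++ : (L M : List A) (φ : A → ℚ) → ∑ (L ++ M) φ ≡ ∑ L φ + ∑ M φ
  ∑-++ []      M φ = sym (ℚP.+-identityˡ _)
  ∑-++ (x ∷ L) M φ = trans (cong (φ x +_) (∑-++ L M φ)) (sym (ℚP.+-assoc (φ x) _ _))

  ∑-map : {B : Set} (L : List B) (g : B → A) (φ : A → ℚ) → ∑ (map g L) φ ≡ ∑ L (φ ∘ g)
  ∑-map []      g φ = refl
  ∑-map (x ∷ L) g φ = cong (φ (g x) +_) (∑-map L g φ)

  ∑-concatMap : {B : Set} (L : List B) (F : B → List A) (φ : A → ℚ) →
                ∑ (concatMap F L) φ ≡ ∑ L (λ b → ∑ (F b) φ)
  ∑-concatMap []      F φ = refl
  ∑-concatMap (b ∷ L) F φ = trans (∑-++ (F b) (concatMap F L) φ) (cong (∑ (F b) φ +_) (∑-concatMap L F φ))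

  ∑-mono : (L : List A) {φ ψ : A → ℚ} → (∀ x → x ∈ L → φ x ≤ ψ x) → ∑ L φ ≤ ∑ L ψ
  ∑-mono []      le = ℚP.≤-refl
  ∑-mono (x ∷ L) le = ℚP.+-mono-≤ (le x (here refl)) (∑-mono L (λ y y∈L → le y (there y∈L)))

  ∑-nonneg : (L : List A) {φ : A → ℚ} → (∀ x → x ∈ L → 0ℚ ≤ φ x) → 0ℚ ≤ ∑ L φ
  ∑-nonneg L le = ℚP.≤-trans (ℚP.≤-reflexive (sym (∑-zero L))) (∑-mono L le)

∑-swap : {A B : Set} (L : List A) (M : List B) (F : A → B → ℚ) →
         ∑ L (λ a → ∑ M (F a)) ≡ ∑ M (λ b → ∑ L (λ a → F a b))
∑-swap []      M F = sym (∑-zero M)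
∑-swap (a ∷ L) M F = trans (cong (∑ M (F a) +_) (∑-swap L M F)) (sym (∑-+ M (F a) (λ b → ∑ L (λ a′ → F a′ b))))

module _ {A : Set} where

  filterᵇ-cong : (L : List A) {p p′ : A → Bool} → (∀ x → x ∈ L → p x ≡ p′ x) → filterᵇ p L ≡ filterᵇ p′ L
  filterᵇ-cong []      eq = refl
  filterᵇ-cong (x ∷ L) {p} {p′} eq with p x | p′ x | eq x (here refl)
  ... | true  | true  | _ = cong (x ∷_) (filterᵇ-cong L (λ y y∈L → eq y (there y∈L)))
  ... | false | false | _ = filterᵇ-cong L (λ y y∈L → eq y (there y∈L))

  ∈-filterᵇ⁻ : (L : List A) (p : A → Bool) {x : A} → x ∈ filterᵇ p L → x ∈ L × p x ≡ true
  ∈-filterᵇ⁻ L p m with ∈-filter⁻ (T? ∘ p) {xs = L} m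
  ... | x∈L , px = x∈L , Equivalence.to BoolP.T-≡ px

  ∈-filterᵇ⁺ : (L : List A) (p : A → Bool) {x : A} → x ∈ L → p x ≡ true → x ∈ filterᵇ p L
  ∈-filterᵇ⁺ L p x∈L px = ∈-filter⁺ (T? ∘ p) x∈L (Equivalence.from BoolP.T-≡ px)

  count-cong : (L : List A) {p p′ : A → Bool} → (∀ x → x ∈ L → p x ≡ p′ x) → count p L ≡ count p′ L
  count-cong L eq = cong length (filterᵇ-cong L eq)

  count-zero : (L : List A) (p : A → Bool) → (∀ x → x ∈ L → p x ≡ false) → count p L ≡ 0
  count-zero []      p none = refl
  count-zero (x ∷ L) p none with p x | none x (here refl)
  ... | false | _ = count-zero L p (λ y y∈L → none y (there y∈L))

  count-pos : (L : List A) (p : A → Bool) {x : A} → x ∈ L → p x ≡ true → ∃[ k ] count p L ≡ suc k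
  count-pos L p x∈L px with filterᵇ p L | ∈-filterᵇ⁺ L p x∈L px
  ... | y ∷ ys | _ = length ys , refl

  filterᵇ-unique : (L : List A) (p : A → Bool) {x : A} → count p L ≡ 1 → x ∈ L → p x ≡ true →
                   filterᵇ p L ≡ x ∷ []
  filterᵇ-unique L p one x∈L px with filterᵇ p L | ∈-filterᵇ⁺ L p x∈L px
  filterᵇ-unique L p refl x∈L px | y ∷ [] | here refl = refl

  ∑-unique : (L : List A) (p : A → Bool) (ψ : A → ℚ) {x : A} → count p L ≡ 1 → x ∈ L → p x ≡ true →
             ∑ L (λ y → if p y then ψ y else 0ℚ) ≡ ψ x
  ∑-unique L p ψ {x} one x∈L px = begin
    ∑ L (λ y → if p y then ψ y else 0ℚ) ≡⟨ sym (∑-filterᵇ L p ψ) ⟩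
    ∑ (filterᵇ p L) ψ                   ≡⟨ cong (λ K → ∑ K ψ) (filterᵇ-unique L p one x∈L px) ⟩
    ψ x + 0ℚ                            ≡⟨ ℚP.+-identityʳ (ψ x) ⟩
    ψ x                                 ∎
    where open ≡-Reasoning

  allᵇ-intro : (L : List A) (p : A → Bool) → (∀ x → x ∈ L → p x ≡ true) → allᵇ p L ≡ true
  allᵇ-intro []      p all = refl
  allᵇ-intro (x ∷ L) p all = ∧-intro (all x (here refl)) (allᵇ-intro L p (λ y y∈L → all y (there y∈L)))

  allᵇ-elim : (L : List A) (p : A → Bool) → allᵇ p L ≡ true → ∀ x → x ∈ L → p x ≡ true
  allᵇ-elim (y ∷ L) p all x (here refl) = BoolP.∧-conicalˡ (p y) _ all
  allᵇ-elim (y ∷ L) p all x (there x∈L) = allᵇ-elim L p (BoolP.∧-conicalʳ (p y) _ all) x x∈L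

  allᵇ-counterexample : (L : List A) (p : A → Bool) → allᵇ p L ≡ false → ∃[ x ] x ∈ L × p x ≡ false
  allᵇ-counterexample (y ∷ L) p none with p y in py
  ... | false = y , here refl , py
  ... | true with allᵇ-counterexample L p none
  ...   | x , x∈L , px = x , there x∈L , px

  allᵇ-cong : (L : List A) {p p′ : A → Bool} → (∀ x → x ∈ L → p x ≡ p′ x) → allᵇ p L ≡ allᵇ p′ L
  allᵇ-cong []      eq = refl
  allᵇ-cong (x ∷ L) eq = cong₂ _∧_ (eq x (here refl)) (allᵇ-cong L (λ y y∈L → eq y (there y∈L)))

  allᵇ-map : {B : Set} (L : List B) (f : B → A) (p : A → Bool) → allᵇ p (map f L) ≡ allᵇ (p ∘ f) L
  allᵇ-map []      f p = refl
  allᵇ-map (x ∷ L) f p = cong (p (f x) ∧_) (allᵇ-map L f p)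

  count-true : (L : List A) → count (λ _ → true) L ≡ length L
  count-true []      = refl
  count-true (x ∷ L) = cong suc (count-true L)

  count-filterᵇ : (L : List A) (r p : A → Bool) → count p (filterᵇ r L) ≡ count (λ x → r x ∧ p x) L
  count-filterᵇ []      r p = refl
  count-filterᵇ (x ∷ L) r p with r x
  ... | false = count-filterᵇ L r p
  ... | true with p x
  ...   | true  = cong suc (count-filterᵇ L r p)
  ...   | false = count-filterᵇ L r p

  count-split : (L : List A) (p r : A → Bool) →
                count p L ≡ count (λ x → p x ∧ r x) L ℕ.+ count (λ x → p x ∧ not (r x)) L
  count-split []      p r = refl
  count-split (x ∷ L) p r with p x | r x
  ... | false | _     = count-split L p r
  ... | true  | true  = cong suc (count-split L p r)
  ... | true  | false = trans (cong suc (count-split L p r)) (sym (ℕP.+-suc _ _))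

  count-mono : (L : List A) {p p′ : A → Bool} → (∀ x → p x ≡ true → p′ x ≡ true) → count p L ℕ.≤ count p′ L
  count-mono []      p⇒p′ = z≤n
  count-mono (x ∷ L) {p} {p′} p⇒p′ with p x in px | p′ x in p′x
  ... | true  | true  = s≤s (count-mono L p⇒p′)
  ... | false | true  = ℕP.m≤n⇒m≤1+n (count-mono L p⇒p′)
  ... | false | false = count-mono L p⇒p′
  ... | true  | false with () ← trans (sym p′x) (p⇒p′ x px)

  count-mono-< : (L : List A) {p p′ : A → Bool} → (∀ x → p x ≡ true → p′ x ≡ true) →
                 ∀ {a} → a ∈ L → p a ≡ false → p′ a ≡ true → count p L ℕ.< count p′ L
  count-mono-< (x ∷ L) p⇒p′ (here refl) pa p′a rewrite pa | p′a = s≤s (count-mono L p⇒p′)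
  count-mono-< (x ∷ L) {p} {p′} p⇒p′ (there a∈L) pa p′a with p x in px | p′ x in p′x
  ... | true  | true  = s≤s (count-mono-< L p⇒p′ a∈L pa p′a)
  ... | false | true  = ℕP.m≤n⇒m≤1+n (count-mono-< L p⇒p′ a∈L pa p′a)
  ... | false | false = count-mono-< L p⇒p′ a∈L pa p′a
  ... | true  | false with () ← trans (sym p′x) (p⇒p′ x px)

  count-∨ : (L : List A) (p r : A → Bool) → count (λ x → p x ∨ r x) L ℕ.≤ count p L ℕ.+ count r L
  count-∨ []      p r = z≤n
  count-∨ (x ∷ L) p r with p x | r x
  ... | true  | true  = s≤s (ℕP.≤-trans (count-∨ L p r) (ℕP.+-monoʳ-≤ (count p L) (ℕP.n≤1+n (count r L))))
  ... | true  | false = s≤s (count-∨ L p r)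
  ... | false | true  = ℕP.≤-trans (s≤s (count-∨ L p r)) (ℕP.≤-reflexive (sym (ℕP.+-suc _ _)))
  ... | false | false = count-∨ L p r

  count-unique : (L : List A) → Unique L → (p : A → Bool) → (∀ x y → p x ≡ true → p y ≡ true → x ≡ y) →
                 ∀ {a} → a ∈ L → p a ≡ true → count p L ≡ 1
  count-unique (x ∷ L) (x∉L ∷ uniq) p p-unique (here refl) px rewrite px =
    cong suc (count-zero L p others)
    where
    others : ∀ y → y ∈ L → p y ≡ false
    others y y∈L with p y in py
    ... | false = refl
    ... | true  = ⊥-elim (All.lookup x∉L y∈L (p-unique x y px py))
  count-unique (x ∷ L) (x∉L ∷ uniq) p p-unique {a} (there a∈L) pa with p x in px
  ... | false = count-unique L uniq p p-unique a∈L pa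
  ... | true  = ⊥-elim (All.lookup x∉L a∈L (p-unique x a px pa))

  count-++ : (L M : List A) (p : A → Bool) → count p (L ++ M) ≡ count p L ℕ.+ count p M
  count-++ L M p = trans (cong length (filter-++ (T? ∘ p) L M)) (length-++ (filterᵇ p L))

  count-map : {B : Set} (L : List B) (f : B → A) (p : A → Bool) → count p (map f L) ≡ count (p ∘ f) L
  count-map []      f p = refl
  count-map (x ∷ L) f p with p (f x)
  ... | true  = cong suc (count-map L f p)
  ... | false = count-map L f p

allᵇ-allFin-suc : ∀ {m} (p : Fin (suc m) → Bool) → allᵇ p (allFin (suc m)) ≡ p zero ∧ allᵇ (p ∘ suc) (allFin m)
allᵇ-allFin-suc {m} p = cong (p zero ∧_) (trans (cong (allᵇ p) (sym (map-tabulate id suc))) (allᵇ-map (allFin m) suc p))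

pick : {A : Set} → (A → Bool) → List A → A → A
pick p L default = fromMaybe default (head (filterᵇ p L))

pick-∈ : {A : Set} (p : A → Bool) (L : List A) (default : A) {k : ℕ} →
         count p L ≡ suc k → pick p L default ∈ filterᵇ p L
pick-∈ p L default nonempty with filterᵇ p L | nonempty
... | x ∷ _ | _ = here refl

module _ {A : Set} where

  avg-map : (L : List A) (φ : A → ℚ) → avg (map φ L) ≡ ∑ L φ * invℕ (length L)
  avg-map L φ = cong (λ k → ∑ L φ * invℕ k) (length-map φ L)

  avg-map-∘ : (L : List A) (φ : A → ℚ) (h : ℚ → ℚ) → avg (map h (map φ L)) ≡ avg (map (h ∘ φ) L)
  avg-map-∘ L φ h = cong avg (sym (map-∘ L))

  avg-cong : (L : List A) {φ ψ : A → ℚ} → (∀ x → x ∈ L → φ x ≡ ψ x) → avg (map φ L) ≡ avg (map ψ L)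
  avg-cong L {φ} {ψ} eq =
    trans (avg-map L φ) (trans (cong (_* invℕ (length L)) (∑-cong L eq)) (sym (avg-map L ψ)))

  avg-zero : (L : List A) → avg (map (λ _ → 0ℚ) L) ≡ 0ℚ
  avg-zero L = trans (avg-map L (λ _ → 0ℚ))
    (trans (cong (_* invℕ (length L)) (∑-zero L)) (ℚP.*-zeroˡ (invℕ (length L))))

  avg-mono : (L : List A) {φ ψ : A → ℚ} → (∀ x → x ∈ L → φ x ≤ ψ x) → avg (map φ L) ≤ avg (map ψ L)
  avg-mono L {φ} {ψ} le = begin
    avg (map φ L)             ≡⟨ avg-map L φ ⟩
    ∑ L φ * invℕ (length L)   ≤⟨ *-monoʳ-≤-nonneg (invℕ-nonneg (length L)) (∑-mono L le) ⟩
    ∑ L ψ * invℕ (length L)   ≡⟨ sym (avg-map L ψ) ⟩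
    avg (map ψ L)             ∎
    where open ℚP.≤-Reasoning

  avg-nonneg : (L : List A) {φ : A → ℚ} → (∀ x → x ∈ L → 0ℚ ≤ φ x) → 0ℚ ≤ avg (map φ L)
  avg-nonneg L le = ℚP.≤-trans (ℚP.≤-reflexive (sym (avg-zero L))) (avg-mono L le)

  variance-map : (L : List A) (φ : A → ℚ) → variance (map φ L) ≡ avg (map (λ x → (φ x - avg (map φ L)) ²) L)
  variance-map L φ = avg-map-∘ L φ (λ y → (y - avg (map φ L)) ²)

  variance-nonneg : (L : List A) (φ : A → ℚ) → 0ℚ ≤ variance (map φ L)
  variance-nonneg L φ = ℚP.≤-trans (avg-nonneg L (λ x _ → square-nonneg (φ x - avg (map φ L))))
                                  (ℚP.≤-reflexive (sym (variance-map L φ)))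

  length*avg : (L : List A) (φ : A → ℚ) → fromℕ (length L) * avg (map φ L) ≡ ∑ L φ
  length*avg []      φ = refl
  length*avg (x ∷ L) φ = begin
    N * avg (map φ (x ∷ L))        ≡⟨ cong (N *_) (avg-map (x ∷ L) φ) ⟩
    N * (∑ (x ∷ L) φ * invℕ (suc k)) ≡⟨ solve 3 (λ N s i → N :* (s :* i) := s :* (i :* N)) refl N (∑ (x ∷ L) φ) _ ⟩
    ∑ (x ∷ L) φ * (invℕ (suc k) * N) ≡⟨ cong (∑ (x ∷ L) φ *_) (invℕ-inverse k) ⟩
    ∑ (x ∷ L) φ * 1ℚ                 ≡⟨ ℚP.*-identityʳ _ ⟩
    ∑ (x ∷ L) φ                      ∎
    where
    open ≡-Reasoning
    k : ℕ
    k = length L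
    N : ℚ
    N = fromℕ (suc k)

  ∑-deviation : (L : List A) (φ : A → ℚ) → ∑ L (λ x → φ x - avg (map φ L)) ≡ 0ℚ
  ∑-deviation L φ = begin
    ∑ L (λ x → φ x - m)   ≡⟨ ∑-+ L φ (λ _ → - m) ⟩
    ∑ L φ + ∑ L (λ _ → - m) ≡⟨ cong₂ _+_ (sym (length*avg L φ)) (∑-const L (- m)) ⟩
    N * m + N * (- m)       ≡⟨ solve 2 (λ N m → N :* m :+ N :* (:- m) := con 0ℚ) refl N m ⟩
    0ℚ                      ∎
    where
    open ≡-Reasoning
    m N : ℚ
    m = avg (map φ L)
    N = fromℕ (length L)

  ∑-square-about : (L : List A) (φ : A → ℚ) (c : ℚ) →
    ∑ L (λ x → (φ x - c) ²) ≡
    ∑ L (λ x → (φ x - avg (map φ L)) ²) + fromℕ (length L) * (avg (map φ L) - c) ²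
  ∑-square-about L φ c = begin
    ∑ L (λ x → (φ x - c) ²)
      ≡⟨ ∑-cong L (λ x _ → solve 3 (λ y m c → (y :- c) :* (y :- c)
           := ((y :- m) :* (y :- m) :+ (con 1ℚ :+ con 1ℚ) :* (m :- c) :* (y :- m)) :+ (m :- c) :* (m :- c)) refl (φ x) m c) ⟩
    ∑ L (λ x → (d x + t * (φ x - m)) + (m - c) ²)
      ≡⟨ ∑-+ L (λ x → d x + t * (φ x - m)) (λ _ → (m - c) ²) ⟩
    ∑ L (λ x → d x + t * (φ x - m)) + ∑ L (λ _ → (m - c) ²)
      ≡⟨ cong₂ _+_ (∑-+ L d (λ x → t * (φ x - m))) (∑-const L ((m - c) ²)) ⟩
    (∑ L d + ∑ L (λ x → t * (φ x - m))) + N * (m - c) ²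
      ≡⟨ cong (λ z → (∑ L d + z) + N * (m - c) ²) (trans (∑-*ˡ L t (λ x → φ x - m)) (cong (t *_) (∑-deviation L φ))) ⟩
    (∑ L d + t * 0ℚ) + N * (m - c) ²
      ≡⟨ cong (λ z → (∑ L d + z) + N * (m - c) ²) (ℚP.*-zeroʳ t) ⟩
    (∑ L d + 0ℚ) + N * (m - c) ²
      ≡⟨ cong (_+ N * (m - c) ²) (ℚP.+-identityʳ (∑ L d)) ⟩
    ∑ L d + N * (m - c) ² ∎
    where
    open ≡-Reasoning
    m N t : ℚ
    m = avg (map φ L)
    N = fromℕ (length L)
    t = (1ℚ + 1ℚ) * (m - c)
    d : A → ℚ
    d x = (φ x - m) ²

  variance≤ : (L : List A) (φ : A → ℚ) (c : ℚ) → variance (map φ L) ≤ avg (map (λ x → (φ x - c) ²) L)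
  variance≤ L φ c = begin
    variance (map φ L)                       ≡⟨ trans (variance-map L φ) (avg-map L _) ⟩
    ∑ L d * i                                ≤⟨ *-monoʳ-≤-nonneg (invℕ-nonneg (length L)) (≤-+-nonneg {∑ L d} N*[m-c]²≥0) ⟩
    (∑ L d + fromℕ (length L) * (m - c) ²) * i ≡⟨ cong (_* i) (sym (∑-square-about L φ c)) ⟩
    ∑ L (λ x → (φ x - c) ²) * i              ≡⟨ sym (avg-map L _) ⟩
    avg (map (λ x → (φ x - c) ²) L)          ∎
    where
    open ℚP.≤-Reasoning
    m i : ℚ
    m = avg (map φ L)
    i = invℕ (length L)
    d : A → ℚ
    d x = (φ x - m) ²
    N*[m-c]²≥0 : 0ℚ ≤ fromℕ (length L) * (m - c) ²
    N*[m-c]²≥0 = *-nonneg (fromℕ-nonneg (length L)) (square-nonneg (m - c))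

module Conditioning {A : Set} (L : List A) {R : A → A → Bool}
  (R-equiv : IsEquivalence (λ x y → R x y ≡ true)) where

  private
    module ≈ = IsEquivalence R-equiv

    R-sym : ∀ x y → R x y ≡ R y x
    R-sym x y = bool-ext ≈.sym ≈.sym

    R-trans : ∀ x y → R x y ≡ true → ∀ z → R x z ≡ R y z
    R-trans x y xy z = bool-ext (≈.trans (≈.sym xy)) (≈.trans xy)

  class : A → List A
  class σ = filterᵇ (R σ) L

  class-eq : ∀ σ τ → R σ τ ≡ true → class σ ≡ class τ
  class-eq σ τ στ = filterᵇ-cong L (λ z _ → R-trans σ τ στ z)

  ∑-avg-class : (Ψ : A → ℚ) → ∑ L (λ σ → avg (map Ψ (class σ))) ≡ ∑ L Ψ
  ∑-avg-class Ψ = begin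
    ∑ L (λ σ → avg (map Ψ (class σ)))
      ≡⟨ ∑-cong L (λ σ _ → trans (avg-map (class σ) Ψ) (cong (_* w σ) (∑-filterᵇ L (R σ) Ψ))) ⟩
    ∑ L (λ σ → ∑ L (λ τ → if R σ τ then Ψ τ else 0ℚ) * w σ)
      ≡⟨ ∑-cong L (λ σ _ → sym (∑-*ʳ L (w σ) (λ τ → if R σ τ then Ψ τ else 0ℚ))) ⟩
    ∑ L (λ σ → ∑ L (λ τ → (if R σ τ then Ψ τ else 0ℚ) * w σ))
      ≡⟨ ∑-swap L L (λ σ τ → (if R σ τ then Ψ τ else 0ℚ) * w σ) ⟩
    ∑ L (λ τ → ∑ L (λ σ → (if R σ τ then Ψ τ else 0ℚ) * w σ))
      ≡⟨ ∑-cong L (λ τ _ → ∑-cong L (λ σ _ → symmetrise τ σ)) ⟩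
    ∑ L (λ τ → ∑ L (λ σ → if R τ σ then Ψ τ * w τ else 0ℚ))
      ≡⟨ ∑-cong L (λ τ τ∈L → trans (∑-count L (R τ) (Ψ τ * w τ)) (class-size τ τ∈L)) ⟩
    ∑ L Ψ ∎
    where
    open ≡-Reasoning
    w : A → ℚ
    w σ = invℕ (length (class σ))
    symmetrise : ∀ τ σ → (if R σ τ then Ψ τ else 0ℚ) * w σ ≡ (if R τ σ then Ψ τ * w τ else 0ℚ)
    symmetrise τ σ with R σ τ in στ | R τ σ in τσ
    ... | true  | true  = cong (λ K → Ψ τ * invℕ (length K)) (class-eq σ τ στ)
    ... | false | false = ℚP.*-zeroˡ (w σ)
    ... | true  | false with () ← trans (sym τσ) (trans (R-sym τ σ) στ)
    ... | false | true  with () ← trans (sym στ) (trans (R-sym σ τ) τσ)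
    class-size : ∀ τ → τ ∈ L → fromℕ (length (class τ)) * (Ψ τ * w τ) ≡ Ψ τ
    class-size τ τ∈L with count-pos L (R τ) τ∈L ≈.refl
    ... | k , |class|≡1+k rewrite |class|≡1+k = begin
      fromℕ (suc k) * (Ψ τ * invℕ (suc k))
        ≡⟨ solve 3 (λ n y i → n :* (y :* i) := y :* (i :* n)) refl (fromℕ (suc k)) (Ψ τ) (invℕ (suc k)) ⟩
      Ψ τ * (invℕ (suc k) * fromℕ (suc k)) ≡⟨ cong (Ψ τ *_) (invℕ-inverse k) ⟩
      Ψ τ * 1ℚ                             ≡⟨ ℚP.*-identityʳ (Ψ τ) ⟩
      Ψ τ                                  ∎

  avg-avg-class : (Ψ : A → ℚ) → avg (map (λ σ → avg (map Ψ (class σ))) L) ≡ avg (map Ψ L)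
  avg-avg-class Ψ =
    trans (avg-map L _) (trans (cong (_* invℕ (length L)) (∑-avg-class Ψ)) (sym (avg-map L Ψ)))

  condMean : (A → ℚ) → A → ℚ
  condMean f σ = avg (map f (class σ))

  condVar : (A → ℚ) → A → ℚ
  condVar f σ = variance (map f (class σ))

  avg-condVar≤ : (f c : A → ℚ) → (∀ σ τ → σ ∈ L → τ ∈ L → R σ τ ≡ true → c σ ≡ c τ) →
                 avg (map (condVar f) L) ≤ avg (map (λ σ → (f σ - c σ) ²) L)
  avg-condVar≤ f c c-invariant = begin
    avg (map (condVar f) L)                                           ≤⟨ avg-mono L pointwise ⟩
    avg (map (λ σ → avg (map (λ τ → (f τ - c τ) ²) (class σ))) L)     ≡⟨ avg-avg-class (λ τ → (f τ - c τ) ²) ⟩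
    avg (map (λ σ → (f σ - c σ) ²) L)                                 ∎
    where
    open ℚP.≤-Reasoning
    pointwise : ∀ σ → σ ∈ L → condVar f σ ≤ avg (map (λ τ → (f τ - c τ) ²) (class σ))
    pointwise σ σ∈L = ℚP.≤-trans (variance≤ (class σ) f (c σ)) (ℚP.≤-reflexive (avg-cong (class σ) c-const))
      where
      c-const : ∀ τ → τ ∈ class σ → (f τ - c σ) ² ≡ (f τ - c τ) ²
      c-const τ τ∈class with ∈-filterᵇ⁻ L (R σ) τ∈class
      ... | τ∈L , στ = cong (λ z → (f τ - z) ²) (c-invariant σ τ σ∈L τ∈L στ)

  avg-condVar≡ : (f : A → ℚ) → avg (map (condVar f) L) ≡ avg (map (λ σ → (f σ - condMean f σ) ²) L)
  avg-condVar≡ f = trans (avg-cong L within-class) (avg-avg-class (λ τ → (f τ - condMean f τ) ²))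
    where
    within-class : ∀ σ → σ ∈ L → condVar f σ ≡ avg (map (λ τ → (f τ - condMean f τ) ²) (class σ))
    within-class σ _ = trans (variance-map (class σ) f) (avg-cong (class σ) same-mean)
      where
      same-mean : ∀ τ → τ ∈ class σ → (f τ - condMean f σ) ² ≡ (f τ - condMean f τ) ²
      same-mean τ τ∈class = cong (λ K → (f τ - avg (map f K)) ²) (class-eq σ τ (proj₂ (∈-filterᵇ⁻ L (R σ) τ∈class)))

  avg-condVar≤variance : (f : A → ℚ) → avg (map (condVar f) L) ≤ variance (map f L)
  avg-condVar≤variance f = ℚP.≤-trans (avg-condVar≤ f (λ _ → avg (map f L)) (λ _ _ _ _ _ → refl))
                                      (ℚP.≤-reflexive (sym (variance-map L f)))

avg-condVar-pullback≤ : {A B : Set} (L : List A) (M : List B) (r : A → B) →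
  (∀ ψ → avg (map (ψ ∘ r) L) ≡ avg (map ψ M)) →
  {R : A → A → Bool} (R-equiv : IsEquivalence (λ x y → R x y ≡ true))
  {Q : B → B → Bool} (Q-equiv : IsEquivalence (λ x y → Q x y ≡ true)) →
  (∀ σ τ → σ ∈ L → τ ∈ L → R σ τ ≡ true → Q (r σ) (r τ) ≡ true) →
  (f : B → ℚ) →
  avg (map (Conditioning.condVar L R-equiv (f ∘ r)) L) ≤ avg (map (Conditioning.condVar M Q-equiv f) M)
avg-condVar-pullback≤ L M r pullback {R} R-equiv Q-equiv respects f = begin
  avg (map (CL.condVar (f ∘ r)) L)                        ≤⟨ CL.avg-condVar≤ (f ∘ r) (CM.condMean f ∘ r) same-mean ⟩
  avg (map (λ σ → (f (r σ) - CM.condMean f (r σ)) ²) L)   ≡⟨ pullback (λ x → (f x - CM.condMean f x) ²) ⟩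
  avg (map (λ x → (f x - CM.condMean f x) ²) M)           ≡⟨ sym (CM.avg-condVar≡ f) ⟩
  avg (map (CM.condVar f) M)                              ∎
  where
  open ℚP.≤-Reasoning
  module CL = Conditioning L R-equiv
  module CM = Conditioning M Q-equiv
  same-mean : ∀ σ τ → σ ∈ L → τ ∈ L → R σ τ ≡ true → CM.condMean f (r σ) ≡ CM.condMean f (r τ)
  same-mean σ τ σ∈L τ∈L στ = cong (λ K → avg (map f K)) (CM.class-eq (r σ) (r τ) (respects σ τ σ∈L τ∈L στ))

module UniformFibres {A B : Set} (L : List A) (M : List B) (over : B → A → Bool) (r : A → B)
  (r∈M : ∀ σ → σ ∈ L → r σ ∈ M) (r-over : ∀ σ → σ ∈ L → over (r σ) σ ≡ true)
  (unique-over : ∀ σ → σ ∈ L → count (λ x → over x σ) M ≡ 1)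
  (K : ℕ) (fibre-size : ∀ x → x ∈ M → count (over x) L ≡ suc K) where

  ∑-pullback : (ψ : B → ℚ) → ∑ L (ψ ∘ r) ≡ fromℕ (suc K) * ∑ M ψ
  ∑-pullback ψ = begin
    ∑ L (ψ ∘ r)
      ≡⟨ ∑-cong L (λ σ σ∈L → sym (∑-unique M (λ x → over x σ) ψ (unique-over σ σ∈L) (r∈M σ σ∈L) (r-over σ σ∈L))) ⟩
    ∑ L (λ σ → ∑ M (λ x → if over x σ then ψ x else 0ℚ))
      ≡⟨ ∑-swap L M (λ σ x → if over x σ then ψ x else 0ℚ) ⟩
    ∑ M (λ x → ∑ L (λ σ → if over x σ then ψ x else 0ℚ))
      ≡⟨ ∑-cong M (λ x x∈M → trans (∑-count L (over x) (ψ x)) (cong (λ k → fromℕ k * ψ x) (fibre-size x x∈M))) ⟩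
    ∑ M (λ x → fromℕ (suc K) * ψ x)
      ≡⟨ ∑-*ˡ M (fromℕ (suc K)) ψ ⟩
    fromℕ (suc K) * ∑ M ψ ∎
    where open ≡-Reasoning

  length-pullback : length L ≡ suc K ℕ.* length M
  length-pullback = fromℕ-injective (begin
    fromℕ (length L)                                ≡⟨ sym (ℚP.*-identityʳ _) ⟩
    fromℕ (length L) * 1ℚ                           ≡⟨ sym (∑-const L 1ℚ) ⟩
    ∑ L (λ _ → 1ℚ)                                  ≡⟨ ∑-pullback (λ _ → 1ℚ) ⟩
    fromℕ (suc K) * ∑ M (λ _ → 1ℚ)                  ≡⟨ cong (fromℕ (suc K) *_) (trans (∑-const M 1ℚ) (ℚP.*-identityʳ _)) ⟩
    fromℕ (suc K) * fromℕ (length M)                ≡⟨ sym (fromℕ-* (suc K) (length M)) ⟩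
    fromℕ (suc K ℕ.* length M)                      ∎)
    where open ≡-Reasoning

  avg-pullback : (ψ : B → ℚ) → avg (map (ψ ∘ r) L) ≡ avg (map ψ M)
  avg-pullback ψ = begin
    avg (map (ψ ∘ r) L)                          ≡⟨ avg-map L (ψ ∘ r) ⟩
    ∑ L (ψ ∘ r) * invℕ (length L)                ≡⟨ cong₂ _*_ (∑-pullback ψ) inv-length ⟩
    (k * s) * (invℕ (suc K) * i)                 ≡⟨ solve 4 (λ k s j i → (k :* s) :* (j :* i) := (s :* i) :* (j :* k))
                                                           refl k s (invℕ (suc K)) i ⟩
    (s * i) * (invℕ (suc K) * k)                 ≡⟨ cong ((s * i) *_) (invℕ-inverse K) ⟩
    (s * i) * 1ℚ                                 ≡⟨ ℚP.*-identityʳ (s * i) ⟩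
    s * i                                        ≡⟨ sym (avg-map M ψ) ⟩
    avg (map ψ M)                                ∎
    where
    open ≡-Reasoning
    k s i : ℚ
    k = fromℕ (suc K)
    s = ∑ M ψ
    i = invℕ (length M)
    inv-length : invℕ (length L) ≡ invℕ (suc K) * i
    inv-length = trans (cong invℕ length-pullback) (invℕ-* (suc K) (length M))

module _ {q : ℕ} where

  eqColᵇ-sound : (a b : Maybe (Fin q)) → eqColᵇ a b ≡ true → a ≡ b
  eqColᵇ-sound a b = ⌊⌋-sound (Maybe.≡-dec Fin._≟_ a b)

  eqColᵇ-refl : (a : Maybe (Fin q)) → eqColᵇ a a ≡ true
  eqColᵇ-refl a = ⌊⌋-true (Maybe.≡-dec Fin._≟_ a a) refl

  eqColᵇ-sym : (a b : Maybe (Fin q)) → eqColᵇ a b ≡ eqColᵇ b a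
  eqColᵇ-sym a b = bool-ext (λ ab → subst (λ c → eqColᵇ c a ≡ true) (eqColᵇ-sound a b ab) (eqColᵇ-refl a))
                            (λ ba → subst (λ c → eqColᵇ c b ≡ true) (eqColᵇ-sound b a ba) (eqColᵇ-refl b))

  module _ {n : ℕ} where

    Agree : (Fin n → Bool) → Colouring n q → Colouring n q → Set
    Agree S σ τ = ∀ e → S e ≡ false → σ e ≡ τ e

    agreeOutsideᵇ-sound : ∀ S σ τ → agreeOutsideᵇ S σ τ ≡ true → Agree S σ τ
    agreeOutsideᵇ-sound S σ τ agree e Se = eqColᵇ-sound (σ e) (τ e)
      (subst (λ b → b ∨ eqColᵇ (σ e) (τ e) ≡ true) Se (allᵇ-elim (allFin n) _ agree e (∈-allFin e)))

    agreeOutsideᵇ-complete : ∀ S σ τ → Agree S σ τ → agreeOutsideᵇ S σ τ ≡ true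
    agreeOutsideᵇ-complete S σ τ agree = allᵇ-intro (allFin n) _ (λ e _ → at e)
      where
      at : ∀ e → S e ∨ eqColᵇ (σ e) (τ e) ≡ true
      at e with S e in Se
      ... | true  = refl
      ... | false = subst (λ c → eqColᵇ (σ e) c ≡ true) (agree e Se) (eqColᵇ-refl (σ e))

    agreeOutsideᵇ-isEquivalence : ∀ S → IsEquivalence (λ σ τ → agreeOutsideᵇ S σ τ ≡ true)
    agreeOutsideᵇ-isEquivalence S = record
      { refl  = λ {σ} → agreeOutsideᵇ-complete S σ σ (λ _ _ → refl)
      ; sym   = λ {σ} {τ} στ → agreeOutsideᵇ-complete S τ σ (λ e Se → sym (agreeOutsideᵇ-sound S σ τ στ e Se))
      ; trans = λ {σ} {τ} {υ} στ τυ → agreeOutsideᵇ-complete S σ υ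
                  (λ e Se → trans (agreeOutsideᵇ-sound S σ τ στ e Se) (agreeOutsideᵇ-sound S τ υ τυ e Se))
      }

    agreeOutsideᵇ-sym : ∀ S σ τ → agreeOutsideᵇ S σ τ ≡ agreeOutsideᵇ S τ σ
    agreeOutsideᵇ-sym S σ τ = bool-ext sym′ sym′
      where
      sym′ : ∀ {σ τ} → agreeOutsideᵇ S σ τ ≡ true → agreeOutsideᵇ S τ σ ≡ true
      sym′ = IsEquivalence.sym (agreeOutsideᵇ-isEquivalence S)

    Proper : (Fin n → Bool) → (Fin n → Fin n → Bool) → Colouring n q → Set
    Proper inE adj c = ∀ e e′ → inE e ≡ true → inE e′ ≡ true → adj e e′ ≡ true → c e ≢ c e′

    properᵇ-sound : ∀ inE adj c → properᵇ inE adj c ≡ true → Proper inE adj c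
    properᵇ-sound inE adj c proper e e′ ine ine′ a ce≡ce′ with
      allᵇ-elim (allFin n) _ (allᵇ-elim (allFin n) _ proper e (∈-allFin e)) e′ (∈-allFin e′)
    ... | clause rewrite ine | ine′ | a | ce≡ce′ | eqColᵇ-refl (c e′) with () ← clause

    properᵇ-complete : ∀ inE adj c → Proper inE adj c → properᵇ inE adj c ≡ true
    properᵇ-complete inE adj c proper =
      allᵇ-intro (allFin n) _ (λ e _ → allᵇ-intro (allFin n) _ (λ e′ _ → clause e e′))
      where
      clause : ∀ e e′ → not (inE e ∧ inE e′ ∧ adj e e′) ∨ not (eqColᵇ (c e) (c e′)) ≡ true
      clause e e′ with inE e in ine | inE e′ in ine′ | adj e e′ in a
      ... | false | _     | _     = refl
      ... | true  | false | _     = refl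
      ... | true  | true  | false = refl
      ... | true  | true  | true with eqColᵇ (c e) (c e′) in same
      ...   | false = refl
      ...   | true  = ⊥-elim (proper e e′ ine ine′ a (eqColᵇ-sound (c e) (c e′) same))

    -- allColourings q inE unfolds to choices n (options inE).
    options : (Fin n → Bool) → Fin n → List (Maybe (Fin q))
    options inE e = if inE e then map just (allFin q) else nothing ∷ []

  -- Colourings are functions, so without function extensionality two colourings in a list
  -- can only be identified up to pointwise equality; uniqueness is phrased as a count.
  pointwiseᵇ : ∀ {n} → Colouring n q → Colouring n q → Bool
  pointwiseᵇ = agreeOutsideᵇ (λ _ → false)

  pointwiseᵇ-cons : ∀ {n} a (h : Colouring n q) (g : Colouring (suc n) q) →
                    pointwiseᵇ (consF a h) g ≡ eqColᵇ a (g zero) ∧ pointwiseᵇ h (g ∘ suc)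
  pointwiseᵇ-cons a h g = allᵇ-allFin-suc (λ e → false ∨ eqColᵇ (consF a h e) (g e))

  ∈-choices⁻ : ∀ {A : Set} n (opts : Fin n → List A) {h : Fin n → A} →
               h ∈ choices n opts → ∀ i → h i ∈ opts i
  ∈-choices⁻ (suc n) opts h∈ i
    with find (∈-concatMap⁻ (λ a → map (consF a) (choices n (opts ∘ suc))) {xs = opts zero} h∈)
  ... | a , a∈ , h∈map with ∈-map⁻ (consF a) h∈map
  ...   | h′ , h′∈ , refl with i
  ...     | zero  = a∈
  ...     | suc j = ∈-choices⁻ n (opts ∘ suc) h′∈ j

  count-choices : ∀ n (opts : Fin n → List (Maybe (Fin q))) (g : Colouring n q) →
                  (∀ i → count (λ a → eqColᵇ a (g i)) (opts i) ≡ 1) →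
                  count (λ h → pointwiseᵇ h g) (choices n opts) ≡ 1
  count-choices zero    opts g one = refl
  count-choices (suc n) opts g one = trans (by-head (opts zero)) (one zero)
    where
    rest : List (Colouring n q)
    rest = choices n (opts ∘ suc)
    IH : count (λ h → pointwiseᵇ h (g ∘ suc)) rest ≡ 1
    IH = count-choices n (opts ∘ suc) (g ∘ suc) (one ∘ suc)
    cons-test : ∀ a h {b} → eqColᵇ a (g zero) ≡ b → pointwiseᵇ (consF a h) g ≡ b ∧ pointwiseᵇ h (g ∘ suc)
    cons-test a h a≡g0 = trans (pointwiseᵇ-cons a h g) (cong (_∧ _) a≡g0)
    tail-count : ∀ a → count (λ h → pointwiseᵇ h g) (map (consF a) rest) ≡ (if eqColᵇ a (g zero) then 1 else 0)
    tail-count a with eqColᵇ a (g zero) in a≡g0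
    ... | true  = trans (count-map rest (consF a) _) (trans (count-cong rest (λ h _ → cons-test a h a≡g0)) IH)
    ... | false = trans (count-map rest (consF a) _) (count-zero rest _ (λ h _ → cons-test a h a≡g0))
    by-head : ∀ as → count (λ h → pointwiseᵇ h g) (concatMap (λ a → map (consF a) rest) as) ≡
                     count (λ a → eqColᵇ a (g zero)) as
    by-head []       = refl
    by-head (a ∷ as)
      with count-++ (map (consF a) rest) (concatMap (λ a → map (consF a) rest) as) (λ h → pointwiseᵇ h g)
    ... | split rewrite tail-count a with eqColᵇ a (g zero)
    ...   | true  = trans split (cong suc (by-head as))
    ...   | false = trans split (by-head as)

  module _ {n : ℕ} (inE : Fin n → Bool) where

    options-just : ∀ e {a} → inE e ≡ true → a ∈ options inE e → ∃[ c ] a ≡ just c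
    options-just e ine a∈ rewrite ine with ∈-map⁻ just a∈
    ... | c , _ , a≡c = c , a≡c

    options-nothing : ∀ e {a} → inE e ≡ false → a ∈ options inE e → a ≡ nothing
    options-nothing e ine a∈ rewrite ine with a∈
    ... | here a≡nothing = a≡nothing

    just∈options : ∀ e c → inE e ≡ true → just c ∈ options inE e
    just∈options e c ine rewrite ine = ∈-map⁺ just (∈-allFin c)

    options-unique : ∀ e → Unique (options inE e)
    options-unique e with inE e
    ... | true  = Unique.map⁺ Maybe.just-injective (Unique.allFin⁺ q)
    ... | false = All.[] ∷ []

    count-options : ∀ e {a} → a ∈ options inE e → count (λ b → eqColᵇ b a) (options inE e) ≡ 1
    count-options e {a} a∈ = count-unique (options inE e) (options-unique e) (λ b → eqColᵇ b a)
      (λ x y x≡a y≡a → trans (eqColᵇ-sound x a x≡a) (sym (eqColᵇ-sound y a y≡a))) a∈ (eqColᵇ-refl a)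

    module _ (adj : Fin n → Fin n → Bool) where

      ∈Ω⁻ : ∀ {c} → c ∈ Ω q inE adj → (∀ e → c e ∈ options inE e) × Proper inE adj c
      ∈Ω⁻ c∈ with ∈-filterᵇ⁻ (allColourings q inE) (properᵇ inE adj) c∈
      ... | c∈all , proper = ∈-choices⁻ n (options inE) c∈all , properᵇ-sound inE adj _ proper

      count-Ω-pointwise : ∀ g → (∀ e → g e ∈ options inE e) → Proper inE adj g →
                          count (λ x → pointwiseᵇ x g) (Ω q inE adj) ≡ 1
      count-Ω-pointwise g g∈ proper = begin
        count (λ x → pointwiseᵇ x g) (Ω q inE adj)
          ≡⟨ count-filterᵇ (allColourings q inE) (properᵇ inE adj) _ ⟩
        count (λ x → properᵇ inE adj x ∧ pointwiseᵇ x g) (allColourings q inE)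
          ≡⟨ count-cong (allColourings q inE) (λ x _ → pointwise⇒proper x) ⟩
        count (λ x → pointwiseᵇ x g) (choices n (options inE))
          ≡⟨ count-choices n (options inE) g (λ e → count-options e (g∈ e)) ⟩
        1 ∎
        where
        open ≡-Reasoning
        pointwise⇒proper : ∀ x → properᵇ inE adj x ∧ pointwiseᵇ x g ≡ pointwiseᵇ x g
        pointwise⇒proper x with pointwiseᵇ x g in x≗g
        ... | false = BoolP.∧-zeroʳ _
        ... | true  = trans (BoolP.∧-identityʳ _) (properᵇ-complete inE adj x
                        (λ e e′ ine ine′ a xe≡xe′ → proper e e′ ine ine′ a
                          (trans (sym (≗ e)) (trans xe≡xe′ (≗ e′)))))
          where
          ≗ : ∀ e → x e ≡ g e
          ≗ e = agreeOutsideᵇ-sound (λ _ → false) x g x≗g e refl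

count-avoiding : ∀ {q} {I : Set} (x : I → Maybe (Fin q)) (J : List I) → Unique J →
  (∀ j → j ∈ J → ∃[ c ] x j ≡ just c) → (∀ i j → i ∈ J → j ∈ J → i ≢ j → x i ≢ x j) →
  count (λ c → allᵇ (λ j → not (eqColᵇ (x j) (just c))) J) (allFin q) ℕ.+ length J ≡ q
count-avoiding {q} x [] _ _ _ = trans (ℕP.+-identityʳ _) (trans (count-true (allFin q)) (length-tabulate id))
count-avoiding {q} x (j ∷ J) (j∉J ∷ uniq) coloured injective with coloured j (here refl)
... | c₀ , xj≡c₀ = begin
  count (avoids (j ∷ J)) (allFin q) ℕ.+ suc (length J)   ≡⟨ ℕP.+-suc _ (length J) ⟩
  suc (count (avoids (j ∷ J)) (allFin q)) ℕ.+ length J   ≡⟨ cong (ℕ._+ length J) (sym split) ⟩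
  count (avoids J) (allFin q) ℕ.+ length J               ≡⟨ count-avoiding x J uniq (λ i i∈ → coloured i (there i∈))
                                                              (λ i i′ i∈ i′∈ → injective i i′ (there i∈) (there i′∈)) ⟩
  q                                                       ∎
  where
  open ≡-Reasoning
  avoids : List _ → Fin q → Bool
  avoids K c = allᵇ (λ i → not (eqColᵇ (x i) (just c))) K
  is-c₀ : Fin q → Bool
  is-c₀ c = eqColᵇ (just c) (just c₀)
  c₀-avoided : avoids J c₀ ≡ true
  c₀-avoided = allᵇ-intro J _ avoided
    where
    avoided : ∀ i → i ∈ J → not (eqColᵇ (x i) (just c₀)) ≡ true
    avoided i i∈ with eqColᵇ (x i) (just c₀) in xi≡c₀
    ... | false = refl
    ... | true  = ⊥-elim (injective j i (here refl) (there i∈) (All.lookup j∉J i∈)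
                    (trans xj≡c₀ (sym (eqColᵇ-sound (x i) (just c₀) xi≡c₀))))
  only-c₀ : count (λ c → avoids J c ∧ is-c₀ c) (allFin q) ≡ 1
  only-c₀ = count-unique (allFin q) (Unique.allFin⁺ q) _
    (λ c c′ c≡ c′≡ → trans (Maybe.just-injective (eqColᵇ-sound _ _ (BoolP.∧-conicalʳ _ _ c≡)))
                            (sym (Maybe.just-injective (eqColᵇ-sound _ _ (BoolP.∧-conicalʳ _ _ c′≡)))))
    (∈-allFin c₀) (∧-intro c₀-avoided (eqColᵇ-refl (just c₀)))
  others : count (λ c → avoids J c ∧ not (is-c₀ c)) (allFin q) ≡ count (avoids (j ∷ J)) (allFin q)
  others = count-cong (allFin q) (λ c _ → trans (BoolP.∧-comm (avoids J c) _)
             (cong (λ b → not b ∧ avoids J c) (trans (eqColᵇ-sym (just c) (just c₀)) (cong (λ a → eqColᵇ a (just c)) (sym xj≡c₀)))))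
  split : count (avoids J) (allFin q) ≡ suc (count (avoids (j ∷ J)) (allFin q))
  split = trans (count-split (allFin q) (avoids J) is-c₀) (cong₂ ℕ._+_ only-c₀ others)

module _ {n : ℕ} (T : RootedTree n) where

  private
    touchᵇ : Fin n → Fin n → Bool
    touchᵇ i j = ⌊ suc i Fin.≟ suc j ⌋ ∨ ⌊ suc i Fin.≟ par T j ⌋ ∨ ⌊ par T i Fin.≟ suc j ⌋ ∨ ⌊ par T i Fin.≟ par T j ⌋

  endpointᵇ-sound : ∀ v i → endpointᵇ T v i ≡ true → v ≡ suc i ⊎ v ≡ par T i
  endpointᵇ-sound v i at with ∨-elim {⌊ v Fin.≟ suc i ⌋} at
  ... | inj₁ child  = inj₁ (⌊⌋-sound (v Fin.≟ suc i) child)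
  ... | inj₂ parent = inj₂ (⌊⌋-sound (v Fin.≟ par T i) parent)

  endpointᵇ-complete : ∀ v i → v ≡ suc i ⊎ v ≡ par T i → endpointᵇ T v i ≡ true
  endpointᵇ-complete v i (inj₁ child)  = ∨-introˡ _ (⌊⌋-true (v Fin.≟ suc i) child)
  endpointᵇ-complete v i (inj₂ parent) = ∨-introʳ _ (⌊⌋-true (v Fin.≟ par T i) parent)

  adjᵇ-sound : ∀ i j → adjᵇ T i j ≡ true → i ≢ j × ∃[ v ] endpointᵇ T v i ≡ true × endpointᵇ T v j ≡ true
  adjᵇ-sound i j a = distinct , shared (BoolP.∧-conicalʳ _ _ a)
    where
    distinct : i ≢ j
    distinct i≡j with () ← trans (sym (cong not (⌊⌋-true (i Fin.≟ j) i≡j))) (BoolP.∧-conicalˡ _ _ a)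
    via : ∀ v → v ≡ suc i ⊎ v ≡ par T i → v ≡ suc j ⊎ v ≡ par T j →
          ∃[ v ] endpointᵇ T v i ≡ true × endpointᵇ T v j ≡ true
    via v vi vj = v , endpointᵇ-complete v i vi , endpointᵇ-complete v j vj
    shared : touchᵇ i j ≡ true → ∃[ v ] endpointᵇ T v i ≡ true × endpointᵇ T v j ≡ true
    shared h with ∨-elim {⌊ suc i Fin.≟ suc j ⌋} h
    ... | inj₁ e = via (suc i) (inj₁ refl) (inj₁ (⌊⌋-sound (suc i Fin.≟ suc j) e))
    ... | inj₂ h′ with ∨-elim {⌊ suc i Fin.≟ par T j ⌋} h′
    ...   | inj₁ e = via (suc i) (inj₁ refl) (inj₂ (⌊⌋-sound (suc i Fin.≟ par T j) e))
    ...   | inj₂ h″ with ∨-elim {⌊ par T i Fin.≟ suc j ⌋} h″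
    ...     | inj₁ e = via (par T i) (inj₂ refl) (inj₁ (⌊⌋-sound (par T i Fin.≟ suc j) e))
    ...     | inj₂ e = via (par T i) (inj₂ refl) (inj₂ (⌊⌋-sound (par T i Fin.≟ par T j) e))

  adjᵇ-complete : ∀ i j v → i ≢ j → endpointᵇ T v i ≡ true → endpointᵇ T v j ≡ true → adjᵇ T i j ≡ true
  adjᵇ-complete i j v i≢j vi vj =
    ∧-intro (cong not (⌊⌋-false (i Fin.≟ j) i≢j)) (shared (endpointᵇ-sound v i vi) (endpointᵇ-sound v j vj))
    where
    shared : v ≡ suc i ⊎ v ≡ par T i → v ≡ suc j ⊎ v ≡ par T j → touchᵇ i j ≡ true
    shared (inj₁ refl) (inj₁ e) = ∨-introˡ _ (⌊⌋-true (suc i Fin.≟ suc j) e)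
    shared (inj₁ refl) (inj₂ e) = ∨-introʳ ⌊ suc i Fin.≟ suc j ⌋ (∨-introˡ _ (⌊⌋-true (suc i Fin.≟ par T j) e))
    shared (inj₂ refl) (inj₁ e) = ∨-introʳ ⌊ suc i Fin.≟ suc j ⌋ (∨-introʳ ⌊ suc i Fin.≟ par T j ⌋
                                    (∨-introˡ _ (⌊⌋-true (par T i Fin.≟ suc j) e)))
    shared (inj₂ refl) (inj₂ e) = ∨-introʳ ⌊ suc i Fin.≟ suc j ⌋ (∨-introʳ ⌊ suc i Fin.≟ par T j ⌋
                                    (∨-introʳ ⌊ par T i Fin.≟ suc j ⌋ (⌊⌋-true (par T i Fin.≟ par T j) e)))

  adjᵇ-irrefl : ∀ i → adjᵇ T i i ≡ false
  adjᵇ-irrefl i with adjᵇ T i i in a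
  ... | false = refl
  ... | true  = ⊥-elim (proj₁ (adjᵇ-sound i i a) refl)

  adjᵇ-sym : ∀ i j → adjᵇ T i j ≡ adjᵇ T j i
  adjᵇ-sym i j = bool-ext (flip i j) (flip j i)
    where
    flip : ∀ i j → adjᵇ T i j ≡ true → adjᵇ T j i ≡ true
    flip i j a with adjᵇ-sound i j a
    ... | i≢j , v , vi , vj = adjᵇ-complete j i v (i≢j ∘ sym) vj vi

  degree≤maxDegree : ∀ v → degree T v ℕ.≤ maxDegree T
  degree≤maxDegree v = ≤-foldr-⊔ (map (degree T) (allFin (suc n))) (∈-map⁺ (degree T) (∈-allFin v))
    where
    ≤-foldr-⊔ : ∀ (ks : List ℕ) {k} → k ∈ ks → k ℕ.≤ foldr ℕ._⊔_ 0 ks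
    ≤-foldr-⊔ (k ∷ ks) (here refl) = ℕP.m≤m⊔n k _
    ≤-foldr-⊔ (k ∷ ks) (there k∈) = ℕP.m≤n⇒m≤o⊔n k (≤-foldr-⊔ ks k∈)

  count-adjᵇ≤ : ∀ e → count (adjᵇ T e) (allFin n) ℕ.≤ maxDegree T ℕ.+ maxDegree T
  count-adjᵇ≤ e = begin
    count (adjᵇ T e) (allFin n)
      ≤⟨ count-mono (allFin n) at-an-end ⟩
    count (λ j → endpointᵇ T (suc e) j ∨ endpointᵇ T (par T e) j) (allFin n)
      ≤⟨ count-∨ (allFin n) _ _ ⟩
    degree T (suc e) ℕ.+ degree T (par T e)
      ≤⟨ ℕP.+-mono-≤ (degree≤maxDegree (suc e)) (degree≤maxDegree (par T e)) ⟩
    maxDegree T ℕ.+ maxDegree T ∎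
    where
    open ℕP.≤-Reasoning
    at-an-end : ∀ j → adjᵇ T e j ≡ true → endpointᵇ T (suc e) j ∨ endpointᵇ T (par T e) j ≡ true
    at-an-end j a with adjᵇ-sound e j a
    ... | _ , v , ve , vj with endpointᵇ-sound v e ve
    ...   | inj₁ refl = ∨-introˡ _ vj
    ...   | inj₂ refl = ∨-introʳ (endpointᵇ T (suc e) j) vj

module Extensions {n : ℕ} (T : RootedTree n) (q : ℕ) where

  ΩT : List (Colouring n q)
  ΩT = Ω q allEdges (adjᵇ T)

  ∈ΩT⁻ : ∀ {σ} → σ ∈ ΩT → (∀ e → ∃[ c ] σ e ≡ just c) × Proper allEdges (adjᵇ T) σ
  ∈ΩT⁻ σ∈ with ∈Ω⁻ allEdges (adjᵇ T) σ∈
  ... | σ∈options , proper = (λ e → options-just allEdges e refl (σ∈options e)) , proper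

  agreeOn : (Fin n → Bool) → Colouring n q → Colouring n q → Bool
  agreeOn G = agreeOutsideᵇ (not ∘ G)

  agreeOn-sound : ∀ G x σ → agreeOn G x σ ≡ true → ∀ e → G e ≡ true → x e ≡ σ e
  agreeOn-sound G x σ agree e Ge = agreeOutsideᵇ-sound (not ∘ G) x σ agree e (cong not Ge)

  agreeOn-complete : ∀ G x σ → (∀ e → G e ≡ true → x e ≡ σ e) → agreeOn G x σ ≡ true
  agreeOn-complete G x σ agree = agreeOutsideᵇ-complete (not ∘ G) x σ on-G
    where
    on-G : Agree (not ∘ G) x σ
    on-G e ¬Ge = agree e (trans (sym (BoolP.not-involutive (G e))) (cong not ¬Ge))

  extensions : (Fin n → Bool) → Colouring n q → ℕ
  extensions G x = count (agreeOn G x) ΩT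

  ProperOn : (Fin n → Bool) → Colouring n q → Set
  ProperOn G x = (∀ e → G e ≡ true → ∃[ c ] x e ≡ just c) × Proper G (adjᵇ T) x

  module _ {G G′ : Fin n → Bool} (G≗G′ : ∀ e → G e ≡ G′ e) where

    extensions-cong : ∀ x → extensions G x ≡ extensions G′ x
    extensions-cong x = count-cong ΩT (λ σ _ → allᵇ-cong (allFin n) (λ e _ → cong (λ b → not b ∨ _) (G≗G′ e)))

    ProperOn-cong : ∀ x → ProperOn G′ x → ProperOn G x
    ProperOn-cong x (coloured , proper) =
      (λ e Ge → coloured e (trans (sym (G≗G′ e)) Ge)) ,
      (λ e e′ Ge Ge′ → proper e e′ (trans (sym (G≗G′ e)) Ge) (trans (sym (G≗G′ e′)) Ge′))

  extensions-all : ∀ G x → (∀ e → G e ≡ true) → ProperOn G x → extensions G x ≡ 1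
  extensions-all G x all (coloured , proper) = begin
    count (agreeOn G x) ΩT                ≡⟨ count-cong ΩT (λ σ _ → on-all σ) ⟩
    count (λ σ → pointwiseᵇ σ x) ΩT       ≡⟨ count-Ω-pointwise allEdges (adjᵇ T) x x∈options x-proper ⟩
    1                                     ∎
    where
    open ≡-Reasoning
    x-proper : Proper allEdges (adjᵇ T) x
    x-proper e e′ _ _ = proper e e′ (all e) (all e′)
    x∈options : ∀ e → x e ∈ options allEdges e
    x∈options e with coloured e (all e)
    ... | c , xe≡c rewrite xe≡c = just∈options allEdges e c refl
    on-all : ∀ σ → agreeOn G x σ ≡ pointwiseᵇ σ x
    on-all σ = bool-ext
      (λ agree → agreeOutsideᵇ-complete _ σ x (λ e _ → sym (agreeOn-sound G x σ agree e (all e))))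
      (λ σ≗x → agreeOn-complete G x σ (λ e _ → sym (agreeOutsideᵇ-sound _ σ x σ≗x e refl)))

  -- The neighbours of e in G pairwise share the parent end of e, so a proper colouring of G gives
  -- them distinct colours and leaves exactly q − |neighbours| colours free for e, for every such colouring.
  module AddEdge (G G⁺ : Fin n → Bool) (e : Fin n) (e∉G : G e ≡ false)
                 (G⁺≗ : ∀ j → G⁺ j ≡ G j ∨ ⌊ j Fin.≟ e ⌋)
                 (neighbours-at-parent : ∀ j → G j ≡ true → adjᵇ T e j ≡ true → endpointᵇ T (par T e) j ≡ true) where

    isNeighbour : Fin n → Bool
    isNeighbour j = G j ∧ adjᵇ T e j

    neighbours : List (Fin n)
    neighbours = filterᵇ isNeighbour (allFin n)

    recolour : Colouring n q → Fin q → Colouring n q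
    recolour x c j = if ⌊ j Fin.≟ e ⌋ then just c else x j

    free : Colouring n q → Fin q → Bool
    free x c = allᵇ (λ j → not (eqColᵇ (x j) (just c))) neighbours

    recolour-e : ∀ x c → recolour x c e ≡ just c
    recolour-e x c rewrite ⌊⌋-true (e Fin.≟ e) refl = refl

    G⇒≢e : ∀ j → G j ≡ true → j ≢ e
    G⇒≢e j Gj refl with () ← trans (sym e∉G) Gj

    recolour-G : ∀ x c j → G j ≡ true → recolour x c j ≡ x j
    recolour-G x c j Gj rewrite ⌊⌋-false (j Fin.≟ e) (G⇒≢e j Gj) = refl

    G⇒G⁺ : ∀ j → G j ≡ true → G⁺ j ≡ true
    G⇒G⁺ j Gj = trans (G⁺≗ j) (∨-introˡ _ Gj)

    e∈G⁺ : G⁺ e ≡ true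
    e∈G⁺ = trans (G⁺≗ e) (∨-introʳ (G e) (⌊⌋-true (e Fin.≟ e) refl))

    G⁺-cases : ∀ j → G⁺ j ≡ true → G j ≡ true ⊎ j ≡ e
    G⁺-cases j G⁺j with ∨-elim {G j} (trans (sym (G⁺≗ j)) G⁺j)
    ... | inj₁ Gj  = inj₁ Gj
    ... | inj₂ j≡e = inj₂ (⌊⌋-sound (j Fin.≟ e) j≡e)

    agreeOn-recolour : ∀ x c σ → agreeOn G⁺ (recolour x c) σ ≡ agreeOn G x σ ∧ eqColᵇ (just c) (σ e)
    agreeOn-recolour x c σ = bool-ext to from
      where
      to : agreeOn G⁺ (recolour x c) σ ≡ true → agreeOn G x σ ∧ eqColᵇ (just c) (σ e) ≡ true
      to agree = ∧-intro
        (agreeOn-complete G x σ (λ j Gj → trans (sym (recolour-G x c j Gj)) (agreeOn-sound G⁺ _ σ agree j (G⇒G⁺ j Gj))))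
        (subst (λ a → eqColᵇ (just c) a ≡ true) (trans (sym (recolour-e x c)) (agreeOn-sound G⁺ _ σ agree e e∈G⁺))
               (eqColᵇ-refl (just c)))
      from : agreeOn G x σ ∧ eqColᵇ (just c) (σ e) ≡ true → agreeOn G⁺ (recolour x c) σ ≡ true
      from both = agreeOn-complete G⁺ _ σ on-G⁺
        where
        on-G⁺ : ∀ j → G⁺ j ≡ true → recolour x c j ≡ σ j
        on-G⁺ j G⁺j with G⁺-cases j G⁺j
        ... | inj₁ Gj   = trans (recolour-G x c j Gj) (agreeOn-sound G x σ (BoolP.∧-conicalˡ _ _ both) j Gj)
        ... | inj₂ refl = trans (recolour-e x c) (eqColᵇ-sound _ _ (BoolP.∧-conicalʳ _ _ both))

    count-colour : ∀ c₀ → count (λ c → eqColᵇ (just c) (just c₀)) (allFin q) ≡ 1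
    count-colour c₀ = count-unique (allFin q) (Unique.allFin⁺ q) _
      (λ c c′ c≡ c′≡ → trans (Maybe.just-injective (eqColᵇ-sound _ _ c≡))
                            (sym (Maybe.just-injective (eqColᵇ-sound _ _ c′≡))))
      (∈-allFin c₀) (eqColᵇ-refl (just c₀))

    extensions-by-colour : ∀ x → fromℕ (extensions G x) ≡ ∑ (allFin q) (λ c → fromℕ (extensions G⁺ (recolour x c)))
    extensions-by-colour x = begin
      fromℕ (extensions G x)                                              ≡⟨ fromℕ-count ΩT (agreeOn G x) ⟩
      ∑ ΩT (λ σ → 𝟙 (agreeOn G x σ))                                      ≡⟨ ∑-cong ΩT one-colour-fits ⟩
      ∑ ΩT (λ σ → ∑ (allFin q) (λ c → 𝟙 (agreeOn G⁺ (recolour x c) σ)))   ≡⟨ ∑-swap ΩT (allFin q) _ ⟩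
      ∑ (allFin q) (λ c → ∑ ΩT (λ σ → 𝟙 (agreeOn G⁺ (recolour x c) σ)))   ≡⟨ ∑-cong (allFin q) (λ c _ → sym (fromℕ-count ΩT _)) ⟩
      ∑ (allFin q) (λ c → fromℕ (extensions G⁺ (recolour x c)))           ∎
      where
      open ≡-Reasoning
      𝟙 : Bool → ℚ
      𝟙 b = if b then 1ℚ else 0ℚ
      one-colour-fits : ∀ σ → σ ∈ ΩT → 𝟙 (agreeOn G x σ) ≡ ∑ (allFin q) (λ c → 𝟙 (agreeOn G⁺ (recolour x c) σ))
      one-colour-fits σ σ∈ with proj₁ (∈ΩT⁻ σ∈) e
      ... | c₀ , σe≡c₀ = trans (by-agreement (agreeOn G x σ)) (∑-cong (allFin q) (λ c _ → cong 𝟙 (sym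
                           (trans (agreeOn-recolour x c σ) (cong (λ a → agreeOn G x σ ∧ eqColᵇ (just c) a) σe≡c₀)))))
        where
        by-agreement : ∀ b → 𝟙 b ≡ ∑ (allFin q) (λ c → 𝟙 (b ∧ eqColᵇ (just c) (just c₀)))
        by-agreement false = sym (∑-zero (allFin q))
        by-agreement true  = sym (trans (sym (fromℕ-count (allFin q) _)) (cong fromℕ (count-colour c₀)))

    ∈-neighbours⁻ : ∀ {j} → j ∈ neighbours → G j ≡ true × adjᵇ T e j ≡ true
    ∈-neighbours⁻ j∈ with ∈-filterᵇ⁻ (allFin n) isNeighbour j∈
    ... | _ , nb = BoolP.∧-conicalˡ (G _) _ nb , BoolP.∧-conicalʳ (G _) _ nb

    free-sound : ∀ x c → free x c ≡ true → ∀ j → G j ≡ true → adjᵇ T e j ≡ true → x j ≢ just c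
    free-sound x c free j Gj a xj≡c with
      allᵇ-elim neighbours _ free j (∈-filterᵇ⁺ (allFin n) isNeighbour (∈-allFin j) (∧-intro Gj a))
    ... | avoided rewrite xj≡c | eqColᵇ-refl (just c) with () ← avoided

    recolour-proper : ∀ x c → ProperOn G x → free x c ≡ true → ProperOn G⁺ (recolour x c)
    recolour-proper x c (coloured , proper) free = coloured⁺ , proper⁺
      where
      coloured⁺ : ∀ j → G⁺ j ≡ true → ∃[ c′ ] recolour x c j ≡ just c′
      coloured⁺ j G⁺j with G⁺-cases j G⁺j
      ... | inj₁ Gj   = proj₁ (coloured j Gj) , trans (recolour-G x c j Gj) (proj₂ (coloured j Gj))
      ... | inj₂ refl = c , recolour-e x c
      proper⁺ : Proper G⁺ (adjᵇ T) (recolour x c)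
      proper⁺ i j G⁺i G⁺j a same with G⁺-cases i G⁺i | G⁺-cases j G⁺j
      ... | inj₁ Gi   | inj₁ Gj   = proper i j Gi Gj a (trans (sym (recolour-G x c i Gi)) (trans same (recolour-G x c j Gj)))
      ... | inj₂ refl | inj₂ refl with () ← trans (sym (adjᵇ-irrefl T e)) a
      ... | inj₂ refl | inj₁ Gj   = free-sound x c free j Gj a
                                      (trans (sym (recolour-G x c j Gj)) (trans (sym same) (recolour-e x c)))
      ... | inj₁ Gi   | inj₂ refl = free-sound x c free i Gi (trans (adjᵇ-sym T e i) a)
                                      (trans (sym (recolour-G x c i Gi)) (trans same (recolour-e x c)))

    recolour-blocked : ∀ x c → free x c ≡ false → extensions G⁺ (recolour x c) ≡ 0
    recolour-blocked x c blocked with allᵇ-counterexample neighbours _ blocked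
    ... | j , j∈ , clash = count-zero ΩT _ no-extension
      where
      Gj : G j ≡ true
      Gj = proj₁ (∈-neighbours⁻ j∈)
      xj≡c : x j ≡ just c
      xj≡c = eqColᵇ-sound _ _ (trans (sym (BoolP.not-involutive _)) (cong not clash))
      no-extension : ∀ σ → σ ∈ ΩT → agreeOn G⁺ (recolour x c) σ ≡ false
      no-extension σ σ∈ with agreeOn G⁺ (recolour x c) σ in agree
      ... | false = refl
      ... | true  = ⊥-elim (proj₂ (∈ΩT⁻ σ∈) e j refl refl (proj₂ (∈-neighbours⁻ j∈)) σe≡σj)
        where
        σe≡σj : σ e ≡ σ j
        σe≡σj = begin
          σ e               ≡⟨ sym (agreeOn-sound G⁺ _ σ agree e e∈G⁺) ⟩
          recolour x c e    ≡⟨ recolour-e x c ⟩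
          just c            ≡⟨ sym xj≡c ⟩
          x j               ≡⟨ sym (recolour-G x c j Gj) ⟩
          recolour x c j    ≡⟨ agreeOn-sound G⁺ _ σ agree j (G⇒G⁺ j Gj) ⟩
          σ j               ∎
          where open ≡-Reasoning

    free-count : ∀ x → ProperOn G x → count (free x) (allFin q) ℕ.+ length neighbours ≡ q
    free-count x (coloured , proper) = count-avoiding x neighbours
      (Unique.filter⁺ (T? ∘ isNeighbour) (Unique.allFin⁺ n))
      (λ j j∈ → coloured j (proj₁ (∈-neighbours⁻ j∈)))
      (λ i j i∈ j∈ i≢j → proper i j (proj₁ (∈-neighbours⁻ i∈)) (proj₁ (∈-neighbours⁻ j∈))
                           (adjᵇ-complete T i j (par T e) i≢j (at-parent i∈) (at-parent j∈)))
      where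
      at-parent : ∀ {j} → j ∈ neighbours → endpointᵇ T (par T e) j ≡ true
      at-parent {j} j∈ = neighbours-at-parent j (proj₁ (∈-neighbours⁻ j∈)) (proj₂ (∈-neighbours⁻ j∈))

    neighbours<q : suc (maxDegree T) ℕ.≤ q → length neighbours ℕ.< q
    neighbours<q Δ<q = begin-strict
      count isNeighbour (allFin n)                  <⟨ count-mono-< (allFin n) nb⇒at-parent (∈-allFin e) e-not-neighbour e-at-parent ⟩
      count (endpointᵇ T (par T e)) (allFin n)      ≤⟨ degree≤maxDegree T (par T e) ⟩
      maxDegree T                                   <⟨ Δ<q ⟩
      q                                             ∎
      where
      open ℕP.≤-Reasoning
      nb⇒at-parent : ∀ j → isNeighbour j ≡ true → endpointᵇ T (par T e) j ≡ true
      nb⇒at-parent j nb = neighbours-at-parent j (BoolP.∧-conicalˡ (G j) _ nb) (BoolP.∧-conicalʳ (G j) _ nb)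
      e-not-neighbour : isNeighbour e ≡ false
      e-not-neighbour rewrite e∉G = refl
      e-at-parent : endpointᵇ T (par T e) e ≡ true
      e-at-parent = endpointᵇ-complete T (par T e) e (inj₂ refl)

    extensions-step : ∀ K → (∀ y → ProperOn G⁺ y → extensions G⁺ y ≡ K) →
                      ∀ x → ProperOn G x → extensions G x ≡ (q ℕ.∸ length neighbours) ℕ.* K
    extensions-step K constant x x-proper = fromℕ-injective (begin
      fromℕ (extensions G x)                                             ≡⟨ extensions-by-colour x ⟩
      ∑ (allFin q) (λ c → fromℕ (extensions G⁺ (recolour x c)))          ≡⟨ ∑-cong (allFin q) (λ c _ → by-freeness c) ⟩
      ∑ (allFin q) (λ c → if free x c then fromℕ K else 0ℚ)              ≡⟨ ∑-count (allFin q) (free x) (fromℕ K) ⟩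
      fromℕ (count (free x) (allFin q)) * fromℕ K                        ≡⟨ sym (fromℕ-* (count (free x) (allFin q)) K) ⟩
      fromℕ (count (free x) (allFin q) ℕ.* K)                            ≡⟨ cong (λ k → fromℕ (k ℕ.* K)) free≡ ⟩
      fromℕ ((q ℕ.∸ length neighbours) ℕ.* K)                            ∎)
      where
      open ≡-Reasoning
      by-freeness : ∀ c → fromℕ (extensions G⁺ (recolour x c)) ≡ (if free x c then fromℕ K else 0ℚ)
      by-freeness c with free x c in free?
      ... | true  = cong fromℕ (constant (recolour x c) (recolour-proper x c x-proper free?))
      ... | false = cong fromℕ (recolour-blocked x c free?)
      free≡ : count (free x) (allFin q) ≡ q ℕ.∸ length neighbours
      free≡ = trans (sym (ℕP.m+n∸n≡m _ (length neighbours))) (cong (ℕ._∸ length neighbours) (free-count x x-proper))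

  module Chain (H : Fin n → Bool) (closed : RootedSubtree T H) (Δ<q : suc (maxDegree T) ℕ.≤ q) where

    -- Edges are added in index order, so each after its parent edge (par-lt); the edges already
    -- present that meet a new edge e outside H can therefore only meet it at its parent end.
    G : ℕ → Fin n → Bool
    G k j = H j ∨ ⌊ toℕ j ℕ.<? k ⌋

    ConstantExtensions : (Fin n → Bool) → Set
    ConstantExtensions S = ∃[ K ] ∀ x → ProperOn S x → extensions S x ≡ suc K

    constant-all : ConstantExtensions (G n)
    constant-all = 0 , λ x x-proper → extensions-all (G n) x (λ j → ∨-introʳ (H j) (⌊⌋-true (_ ℕ.<? n) (FinP.toℕ<n j))) x-proper

    module _ (k : ℕ) (e : Fin n) (e≡k : toℕ e ≡ k) where

      G-suc : ∀ j → G (suc k) j ≡ G k j ∨ ⌊ j Fin.≟ e ⌋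
      G-suc j = trans (cong (H j ∨_) (bool-ext to from)) (sym (BoolP.∨-assoc (H j) _ _))
        where
        to : ⌊ toℕ j ℕ.<? suc k ⌋ ≡ true → ⌊ toℕ j ℕ.<? k ⌋ ∨ ⌊ j Fin.≟ e ⌋ ≡ true
        to j<1+k with ℕP.m≤n⇒m<n∨m≡n (ℕP.≤-pred (⌊⌋-sound (_ ℕ.<? suc k) j<1+k))
        ... | inj₁ j<k = ∨-introˡ _ (⌊⌋-true (_ ℕ.<? k) j<k)
        ... | inj₂ j≡k = ∨-introʳ _ (⌊⌋-true (j Fin.≟ e) (FinP.toℕ-injective (trans j≡k (sym e≡k))))
        from : ⌊ toℕ j ℕ.<? k ⌋ ∨ ⌊ j Fin.≟ e ⌋ ≡ true → ⌊ toℕ j ℕ.<? suc k ⌋ ≡ true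
        from j≤k with ∨-elim {⌊ toℕ j ℕ.<? k ⌋} j≤k
        ... | inj₁ j<k = ⌊⌋-true (_ ℕ.<? suc k) (ℕP.m≤n⇒m≤1+n (⌊⌋-sound (_ ℕ.<? k) j<k))
        ... | inj₂ j≡e = ⌊⌋-true (_ ℕ.<? suc k) (s≤s (ℕP.≤-reflexive (trans (cong toℕ (⌊⌋-sound (j Fin.≟ e) j≡e)) e≡k)))

      module _ (e∉H : H e ≡ false) where

        e∉G : G k e ≡ false
        e∉G rewrite e∉H = ⌊⌋-false (_ ℕ.<? k) (λ e<k → ℕP.<-irrefl e≡k e<k)

        earlier-neighbours-at-parent : ∀ j → G k j ≡ true → adjᵇ T e j ≡ true → endpointᵇ T (par T e) j ≡ true
        earlier-neighbours-at-parent j Gj a with adjᵇ-sound T e j a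
        ... | e≢j , v , ve , vj with endpointᵇ-sound T v e ve
        ...   | inj₂ refl = vj
        ...   | inj₁ refl with endpointᵇ-sound T (suc e) j vj
        ...     | inj₁ e≡j = ⊥-elim (e≢j (FinP.suc-injective e≡j))
        ...     | inj₂ j-child-of-e with ∨-elim {H j} Gj
        ...       | inj₁ Hj  with () ← trans (sym e∉H) (closed j e Hj (sym j-child-of-e))
        ...       | inj₂ j<k = ⊥-elim (ℕP.<-irrefl refl (ℕP.<-≤-trans (⌊⌋-sound (_ ℕ.<? k) j<k) (ℕP.<⇒≤ k<j)))
          where
          k<j : k ℕ.< toℕ j
          k<j = ℕP.≤-trans (s≤s (ℕP.≤-reflexive (sym e≡k))) (ℕP.≤-trans (ℕP.≤-reflexive (cong toℕ j-child-of-e)) (par-lt T j))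

      constant-step : ConstantExtensions (G (suc k)) → ConstantExtensions (G k)
      constant-step (K , constant) with H e in e∈H?
      ... | true  = K , λ x x-proper → trans (extensions-cong (λ j → sym (G-same j)) x) (constant x (ProperOn-cong G-same x x-proper))
        where
        G-same : ∀ j → G (suc k) j ≡ G k j
        G-same j = trans (G-suc j) (bool-ext already-in (∨-introˡ _))
          where
          already-in : G k j ∨ ⌊ j Fin.≟ e ⌋ ≡ true → G k j ≡ true
          already-in Gj∨j≡e with ∨-elim {G k j} Gj∨j≡e
          ... | inj₁ Gj  = Gj
          ... | inj₂ j≡e rewrite ⌊⌋-sound (j Fin.≟ e) j≡e = ∨-introˡ _ e∈H?
      ... | false = K ℕ.+ m ℕ.* suc K , λ x x-proper → trans (extensions-step (suc K) constant x x-proper) (cong (ℕ._* suc K) free≡1+m)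
        where
        open AddEdge (G k) (G (suc k)) e (e∉G e∈H?) G-suc (earlier-neighbours-at-parent e∈H?)
        free-colours : ∃[ m ] q ℕ.∸ length neighbours ≡ suc m
        free-colours with q ℕ.∸ length neighbours | ℕP.m<n⇒0<n∸m (neighbours<q Δ<q)
        ... | suc m | _ = m , refl
        m : ℕ
        m = proj₁ free-colours
        free≡1+m : q ℕ.∸ length neighbours ≡ suc m
        free≡1+m = proj₂ free-colours

    constant-from : ∀ d k → d ℕ.+ k ≡ n → ConstantExtensions (G k)
    constant-from zero    k refl = constant-all
    constant-from (suc d) k d+k≡n =
      constant-step k (Fin.fromℕ< k<n) (FinP.toℕ-fromℕ< k<n) (constant-from d (suc k) (trans (ℕP.+-suc d k) d+k≡n))
      where
      k<n : k ℕ.< n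
      k<n = ℕP.≤-trans (s≤s (ℕP.m≤n+m k d)) (ℕP.≤-reflexive d+k≡n)

    constant-H : ∃[ K ] ∀ x → x ∈ Ω q H (adjᵇ T) → extensions H x ≡ suc K
    constant-H with constant-from n 0 (ℕP.+-identityʳ n)
    ... | K , constant = K , λ x x∈ →
      trans (extensions-cong (λ j → sym (G-zero j)) x) (constant x (ProperOn-cong G-zero x (ΩH-proper x∈)))
      where
      G-zero : ∀ j → G 0 j ≡ H j
      G-zero j = BoolP.∨-identityʳ (H j)
      ΩH-proper : ∀ {x} → x ∈ Ω q H (adjᵇ T) → ProperOn H x
      ΩH-proper x∈ with ∈Ω⁻ H (adjᵇ T) x∈
      ... | x∈options , proper = (λ e He → options-just H e He (x∈options e)) , proper

module Restriction {n : ℕ} (T : RootedTree n) (q : ℕ) (H : Fin n → Bool)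
                   (closed : RootedSubtree T H) (Δ<q : suc (maxDegree T) ℕ.≤ q) where

  open Extensions T q

  ΩH : List (Colouring n q)
  ΩH = Ω q H (adjᵇ T)

  erase : Colouring n q → Colouring n q
  erase σ e = if H e then σ e else nothing

  -- On ΩT this is the unique colouring in ΩH agreeing with σ on H; the default σ is never returned there.
  restrict : Colouring n q → Colouring n q
  restrict σ = pick (λ x → agreeOn H x σ) ΩH σ

  off-H : ∀ {x} → x ∈ ΩH → ∀ e → H e ≡ false → x e ≡ nothing
  off-H x∈ e e∉H = options-nothing H e e∉H (proj₁ (∈Ω⁻ H (adjᵇ T) x∈) e)

  agreeOn-H : ∀ {x} σ → x ∈ ΩH → agreeOn H x σ ≡ pointwiseᵇ x (erase σ)
  agreeOn-H {x} σ x∈ = bool-ext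
    (λ agree → agreeOutsideᵇ-complete _ x (erase σ) (λ e _ → on e (agreeOn-sound H x σ agree e)))
    (λ x≗ → agreeOn-complete H x σ (λ e He → trans (agreeOutsideᵇ-sound _ x (erase σ) x≗ e refl) (erase-H e He)))
    where
    erase-H : ∀ e → H e ≡ true → erase σ e ≡ σ e
    erase-H e He rewrite He = refl
    on : ∀ e → (H e ≡ true → x e ≡ σ e) → x e ≡ erase σ e
    on e agree with H e in He
    ... | true  = agree refl
    ... | false = off-H x∈ e He

  unique-restriction : ∀ σ → σ ∈ ΩT → count (λ x → agreeOn H x σ) ΩH ≡ 1
  unique-restriction σ σ∈ = trans (count-cong ΩH (λ x x∈ → agreeOn-H σ x∈))
    (count-Ω-pointwise H (adjᵇ T) (erase σ) erased∈options erased-proper)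
    where
    erased∈options : ∀ e → erase σ e ∈ options H e
    erased∈options e with H e in He
    ... | false = here refl
    ... | true with proj₁ (∈ΩT⁻ σ∈) e
    ...   | c , σe≡c rewrite σe≡c = ∈-map⁺ just (∈-allFin c)
    erased-proper : Proper H (adjᵇ T) (erase σ)
    erased-proper e e′ He He′ a same rewrite He | He′ = proj₂ (∈ΩT⁻ σ∈) e e′ refl refl a same

  restrict-∈ : ∀ σ → σ ∈ ΩT → restrict σ ∈ filterᵇ (λ x → agreeOn H x σ) ΩH
  restrict-∈ σ σ∈ = pick-∈ (λ x → agreeOn H x σ) ΩH σ (unique-restriction σ σ∈)

  restrict≗erase : ∀ σ → σ ∈ ΩT → ∀ e → restrict σ e ≡ erase σ e
  restrict≗erase σ σ∈ e with ∈-filterᵇ⁻ ΩH _ (restrict-∈ σ σ∈)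
  ... | r∈ , agree = agreeOutsideᵇ-sound _ (restrict σ) (erase σ) (trans (sym (agreeOn-H σ r∈)) agree) e refl

  module Fibres = UniformFibres ΩT ΩH (agreeOn H) restrict
    (λ σ σ∈ → proj₁ (∈-filterᵇ⁻ ΩH _ (restrict-∈ σ σ∈)))
    (λ σ σ∈ → proj₂ (∈-filterᵇ⁻ ΩH _ (restrict-∈ σ σ∈)))
    unique-restriction
    (proj₁ (Chain.constant-H H closed Δ<q)) (proj₂ (Chain.constant-H H closed Δ<q))

  variance-restrict : (f : Colouring n q → ℚ) →
                      Var {n} {q} allEdges (adjᵇ T) (f ∘ restrict) ≡ Var {n} {q} H (adjᵇ T) f
  variance-restrict f = begin
    variance (map (f ∘ restrict) ΩT)
      ≡⟨ variance-map ΩT (f ∘ restrict) ⟩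
    avg (map (λ σ → (f (restrict σ) - avg (map (f ∘ restrict) ΩT)) ²) ΩT)
      ≡⟨ cong (λ m → avg (map (λ σ → (f (restrict σ) - m) ²) ΩT)) (Fibres.avg-pullback f) ⟩
    avg (map (λ σ → (f (restrict σ) - m) ²) ΩT)
      ≡⟨ Fibres.avg-pullback (λ x → (f x - m) ²) ⟩
    avg (map (λ x → (f x - m) ²) ΩH)
      ≡⟨ sym (variance-map ΩH f) ⟩
    variance (map f ΩH) ∎
    where
    open ≡-Reasoning
    m : ℚ
    m = avg (map f ΩH)

  restrict-respects : ∀ S σ τ → σ ∈ ΩT → τ ∈ ΩT →
                      agreeOutsideᵇ S σ τ ≡ true → agreeOutsideᵇ S (restrict σ) (restrict τ) ≡ true
  restrict-respects S σ τ σ∈ τ∈ στ = agreeOutsideᵇ-complete S (restrict σ) (restrict τ) λ e Se → begin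
    restrict σ e   ≡⟨ restrict≗erase σ σ∈ e ⟩
    erase σ e      ≡⟨ cong (λ c → if H e then c else nothing) (agreeOutsideᵇ-sound S σ τ στ e Se) ⟩
    erase τ e      ≡⟨ sym (restrict≗erase τ τ∈ e) ⟩
    restrict τ e   ∎
    where open ≡-Reasoning

  condVar-restrict≤ : ∀ S (f : Colouring n q → ℚ) →
    Exp {n} {q} allEdges (adjᵇ T) (VarS {n} {q} allEdges (adjᵇ T) S (f ∘ restrict)) ≤
    Exp {n} {q} H (adjᵇ T) (VarS {n} {q} H (adjᵇ T) S f)
  condVar-restrict≤ S = avg-condVar-pullback≤ ΩT ΩH restrict Fibres.avg-pullback
    (agreeOutsideᵇ-isEquivalence S) (agreeOutsideᵇ-isEquivalence S) (restrict-respects S)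

module _ {n : ℕ} where

  -- Definitionally equal to the singleton and pair of Defs, whatever their edge set.
  ⁅_⁆ : Fin n → Fin n → Bool
  ⁅ e ⁆ x = ⌊ x Fin.≟ e ⌋

  ⁅_⁆∪⁅_⁆ : Fin n → Fin n → Fin n → Bool
  ⁅ e ⁆∪⁅ e′ ⁆ x = ⌊ x Fin.≟ e ⌋ ∨ ⌊ x Fin.≟ e′ ⌋

  ∑-𝒫 : ∀ {q} (inE : Fin n → Bool) (adj : Fin n → Fin n → Bool) (φ : (Fin n → Bool) → ℚ) →
    ∑ (𝒫 {n} {q} inE adj) φ ≡
      ∑ (allFin n) (λ e → if inE e then φ ⁅ e ⁆ else 0ℚ) +
      ∑ (allFin n) (λ e → ∑ (allFin n) (λ e′ →
        if inE e ∧ inE e′ ∧ adj e e′ ∧ ⌊ e FinP.<? e′ ⌋ then φ ⁅ e ⁆∪⁅ e′ ⁆ else 0ℚ))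
  ∑-𝒫 inE adj φ = begin
    ∑ (singletons ++ concatMap pairs (allFin n)) φ
      ≡⟨ ∑-++ singletons (concatMap pairs (allFin n)) φ ⟩
    ∑ singletons φ + ∑ (concatMap pairs (allFin n)) φ
      ≡⟨ cong₂ _+_ (trans (∑-map (filterᵇ inE (allFin n)) ⁅_⁆ φ) (∑-filterᵇ (allFin n) inE (φ ∘ ⁅_⁆)))
                   (trans (∑-concatMap (allFin n) pairs φ) (∑-cong (allFin n) (λ e _ → ∑-pairs e))) ⟩
    ∑ (allFin n) (λ e → if inE e then φ ⁅ e ⁆ else 0ℚ) +
    ∑ (allFin n) (λ e → ∑ (allFin n) (λ e′ → if partner e e′ then φ ⁅ e ⁆∪⁅ e′ ⁆ else 0ℚ)) ∎
    where
    open ≡-Reasoning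
    singletons : List (Fin n → Bool)
    singletons = map ⁅_⁆ (filterᵇ inE (allFin n))
    partner : Fin n → Fin n → Bool
    partner e e′ = inE e ∧ inE e′ ∧ adj e e′ ∧ ⌊ e FinP.<? e′ ⌋
    pairs : Fin n → List (Fin n → Bool)
    pairs e = map ⁅ e ⁆∪⁅_⁆ (filterᵇ (partner e) (allFin n))
    ∑-pairs : ∀ e → ∑ (pairs e) φ ≡ ∑ (allFin n) (λ e′ → if partner e e′ then φ ⁅ e ⁆∪⁅ e′ ⁆ else 0ℚ)
    ∑-pairs e = trans (∑-map (filterᵇ (partner e) (allFin n)) ⁅ e ⁆∪⁅_⁆ φ)
                      (∑-filterᵇ (allFin n) (partner e) (λ e′ → φ ⁅ e ⁆∪⁅ e′ ⁆))

-- Since E S depends only on S ∩ H, every term of the sum over 𝒫 for T is bounded by terms of the sum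
-- for H; a singleton {e} ⊆ H is charged once by itself and at most twice for each of the ≤ 2Δ edges
-- adjacent to e, whence the factor κ = 1 + 4Δ.
module LocalisedSums {n : ℕ} (q : ℕ) (T : RootedTree n) (H : Fin n → Bool) (E : (Fin n → Bool) → ℚ)
  (E-nonneg : ∀ S → 0ℚ ≤ E S)
  (E-local : ∀ S S′ → (∀ e → H e ≡ true → S e ≡ S′ e) → E S ≡ E S′)
  (E-∅ : E (λ _ → false) ≡ 0ℚ) where

  private
    Fs : List (Fin n)
    Fs = allFin n
    adj : Fin n → Fin n → Bool
    adj = adjᵇ T

  W : Fin n → ℚ
  W e = if H e then E ⁅ e ⁆ else 0ℚ

  degreeᵉ : Fin n → ℕ
  degreeᵉ e = count (adj e) Fs

  W-nonneg : ∀ e → 0ℚ ≤ W e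
  W-nonneg e with H e
  ... | true  = E-nonneg ⁅ e ⁆
  ... | false = ℚP.≤-refl

  if-nonneg : ∀ b {x} → 0ℚ ≤ x → 0ℚ ≤ (if b then x else 0ℚ)
  if-nonneg true  0≤x = 0≤x
  if-nonneg false _   = ℚP.≤-refl

  E-off-H : ∀ S → (∀ e → H e ≡ true → S e ≡ false) → E S ≡ 0ℚ
  E-off-H S off = trans (E-local S (λ _ → false) off) E-∅

  H-separates : ∀ {a b} → H a ≡ true → H b ≡ false → a ≢ b
  H-separates Ha Hb refl with () ← trans (sym Hb) Ha

  E-single : ∀ e → E ⁅ e ⁆ ≡ W e
  E-single e with H e in He
  ... | true  = refl
  ... | false = E-off-H ⁅ e ⁆ (λ x Hx → ⌊⌋-false (x Fin.≟ e) (H-separates Hx He))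

  E-pair≤ : ∀ e e′ → E ⁅ e ⁆∪⁅ e′ ⁆ ≤ (W e + W e′) + (if H e ∧ H e′ then E ⁅ e ⁆∪⁅ e′ ⁆ else 0ℚ)
  E-pair≤ e e′ with H e in He | H e′ in He′
  ... | true  | true  = ℚP.≤-trans (≤-+-nonneg (ℚP.+-mono-≤ (E-nonneg ⁅ e ⁆) (E-nonneg ⁅ e′ ⁆)))
                                   (ℚP.≤-reflexive (ℚP.+-comm _ (E ⁅ e ⁆ + E ⁅ e′ ⁆)))
  ... | true  | false = ℚP.≤-reflexive (begin
    E ⁅ e ⁆∪⁅ e′ ⁆       ≡⟨ E-local _ ⁅ e ⁆ (λ x Hx → trans (cong (⌊ x Fin.≟ e ⌋ ∨_) (⌊⌋-false (x Fin.≟ e′) (H-separates Hx He′)))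
                                                            (BoolP.∨-identityʳ _)) ⟩
    E ⁅ e ⁆              ≡⟨ sym (trans (ℚP.+-identityʳ _) (ℚP.+-identityʳ _)) ⟩
    (E ⁅ e ⁆ + 0ℚ) + 0ℚ  ∎)
    where open ≡-Reasoning
  ... | false | true  = ℚP.≤-reflexive (begin
    E ⁅ e ⁆∪⁅ e′ ⁆       ≡⟨ E-local _ ⁅ e′ ⁆ (λ x Hx → cong (_∨ ⌊ x Fin.≟ e′ ⌋) (⌊⌋-false (x Fin.≟ e) (H-separates Hx He))) ⟩
    E ⁅ e′ ⁆             ≡⟨ sym (trans (ℚP.+-identityʳ _) (ℚP.+-identityˡ _)) ⟩
    (0ℚ + E ⁅ e′ ⁆) + 0ℚ ∎)
    where open ≡-Reasoning
  ... | false | false = ℚP.≤-reflexive (E-off-H _ off)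
    where
    off : ∀ x → H x ≡ true → ⌊ x Fin.≟ e ⌋ ∨ ⌊ x Fin.≟ e′ ⌋ ≡ false
    off x Hx rewrite ⌊⌋-false (x Fin.≟ e) (H-separates Hx He) = ⌊⌋-false (x Fin.≟ e′) (H-separates Hx He′)

  private
    lt : Fin n → Fin n → Bool
    lt e e′ = ⌊ e FinP.<? e′ ⌋

  pair-bound : ∀ e e′ →
    (if adj e e′ ∧ lt e e′ then E ⁅ e ⁆∪⁅ e′ ⁆ else 0ℚ) ≤
    (if adj e e′ then W e + W e′ else 0ℚ) + (if H e ∧ H e′ ∧ adj e e′ ∧ lt e e′ then E ⁅ e ⁆∪⁅ e′ ⁆ else 0ℚ)
  pair-bound e e′ with adj e e′ | lt e e′
  ... | false | _     = ℚP.+-mono-≤ ℚP.≤-refl (if-nonneg (H e ∧ H e′ ∧ false) (E-nonneg _))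
  ... | true  | false = ℚP.+-mono-≤ (ℚP.+-mono-≤ (W-nonneg e) (W-nonneg e′)) (if-nonneg (H e ∧ H e′ ∧ false) (E-nonneg _))
  ... | true  | true  = ℚP.≤-trans (E-pair≤ e e′)
    (ℚP.≤-reflexive (cong (λ b → (W e + W e′) + (if b then E ⁅ e ⁆∪⁅ e′ ⁆ else 0ℚ))
                          (cong (H e ∧_) (sym (BoolP.∧-identityʳ (H e′))))))

  ∑-adjacent-pairs : ∑ Fs (λ e → ∑ Fs (λ e′ → if adj e e′ then W e + W e′ else 0ℚ)) ≡
                     ∑ Fs (λ e → fromℕ (degreeᵉ e ℕ.+ degreeᵉ e) * W e)
  ∑-adjacent-pairs = begin
    ∑ Fs (λ e → ∑ Fs (λ e′ → if adj e e′ then W e + W e′ else 0ℚ))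
      ≡⟨ ∑-cong Fs (λ e _ → trans (∑-cong Fs (λ e′ _ → if-+ (adj e e′))) (∑-+ Fs _ _)) ⟩
    ∑ Fs (λ e → ∑ Fs (λ e′ → if adj e e′ then W e else 0ℚ) + ∑ Fs (λ e′ → if adj e e′ then W e′ else 0ℚ))
      ≡⟨ ∑-+ Fs _ _ ⟩
    ∑ Fs (λ e → ∑ Fs (λ e′ → if adj e e′ then W e else 0ℚ)) + ∑ Fs (λ e → ∑ Fs (λ e′ → if adj e e′ then W e′ else 0ℚ))
      ≡⟨ cong (∑ Fs (λ e → ∑ Fs (λ e′ → if adj e e′ then W e else 0ℚ)) +_) swap-ends ⟩
    ∑ Fs (λ e → ∑ Fs (λ e′ → if adj e e′ then W e else 0ℚ)) + ∑ Fs (λ e′ → ∑ Fs (λ e → if adj e′ e then W e′ else 0ℚ))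
      ≡⟨ cong₂ _+_ (∑-cong Fs (λ e _ → ∑-count Fs (adj e) (W e))) (∑-cong Fs (λ e _ → ∑-count Fs (adj e) (W e))) ⟩
    ∑ Fs (λ e → fromℕ (degreeᵉ e) * W e) + ∑ Fs (λ e → fromℕ (degreeᵉ e) * W e)
      ≡⟨ sym (∑-+ Fs _ _) ⟩
    ∑ Fs (λ e → fromℕ (degreeᵉ e) * W e + fromℕ (degreeᵉ e) * W e)
      ≡⟨ ∑-cong Fs (λ e _ → trans (sym (ℚP.*-distribʳ-+ (W e) (fromℕ (degreeᵉ e)) (fromℕ (degreeᵉ e))))
                                  (cong (_* W e) (sym (fromℕ-+ (degreeᵉ e) (degreeᵉ e))))) ⟩
    ∑ Fs (λ e → fromℕ (degreeᵉ e ℕ.+ degreeᵉ e) * W e) ∎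
    where
    open ≡-Reasoning
    swap-ends : ∑ Fs (λ e → ∑ Fs (λ e′ → if adj e e′ then W e′ else 0ℚ)) ≡
                ∑ Fs (λ e′ → ∑ Fs (λ e → if adj e′ e then W e′ else 0ℚ))
    swap-ends = trans (∑-swap Fs Fs _)
      (∑-cong Fs (λ e′ _ → ∑-cong Fs (λ e _ → cong (λ b → if b then W e′ else 0ℚ) (adjᵇ-sym T e e′))))
    if-+ : ∀ b {x y} → (if b then x + y else 0ℚ) ≡ (if b then x else 0ℚ) + (if b then y else 0ℚ)
    if-+ true  = refl
    if-+ false = refl

  κ : ℕ
  κ = suc ((maxDegree T ℕ.+ maxDegree T) ℕ.+ (maxDegree T ℕ.+ maxDegree T))

  ∑𝒫-bound : ∑ (𝒫 {n} {q} allEdges adj) E ≤ fromℕ κ * ∑ (𝒫 {n} {q} H adj) E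
  ∑𝒫-bound = begin
    ∑ (𝒫 {n} {q} allEdges adj) E                          ≡⟨ ∑-𝒫 {q = q} allEdges adj E ⟩
    ∑ Fs (λ e → E ⁅ e ⁆) + X                               ≡⟨ cong (_+ X) (∑-cong Fs (λ e _ → E-single e)) ⟩
    ∑ Fs W + X                                             ≤⟨ ℚP.+-monoʳ-≤ (∑ Fs W) X≤ ⟩
    ∑ Fs W + (∑ Fs (λ e → d e * W e) + P)                  ≡⟨ sym (ℚP.+-assoc (∑ Fs W) _ P) ⟩
    (∑ Fs W + ∑ Fs (λ e → d e * W e)) + P                  ≡⟨ cong (_+ P) (sym (∑-+ Fs W (λ e → d e * W e))) ⟩
    ∑ Fs (λ e → W e + d e * W e) + P                       ≤⟨ ℚP.+-mono-≤ (∑-mono Fs (λ e _ → single≤ e)) P≤κP ⟩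
    ∑ Fs (λ e → fromℕ κ * W e) + fromℕ κ * P               ≡⟨ cong (_+ fromℕ κ * P) (∑-*ˡ Fs (fromℕ κ) W) ⟩
    fromℕ κ * ∑ Fs W + fromℕ κ * P                         ≡⟨ sym (ℚP.*-distribˡ-+ (fromℕ κ) (∑ Fs W) P) ⟩
    fromℕ κ * (∑ Fs W + P)                                 ≡⟨ cong (fromℕ κ *_) (sym (∑-𝒫 {q = q} H adj E)) ⟩
    fromℕ κ * ∑ (𝒫 {n} {q} H adj) E                       ∎
    where
    open ℚP.≤-Reasoning
    d : Fin n → ℚ
    d e = fromℕ (degreeᵉ e ℕ.+ degreeᵉ e)
    A B : Fin n → Fin n → ℚ
    A e e′ = if adj e e′ then W e + W e′ else 0ℚ
    B e e′ = if H e ∧ H e′ ∧ adj e e′ ∧ lt e e′ then E ⁅ e ⁆∪⁅ e′ ⁆ else 0ℚ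
    X P : ℚ
    X = ∑ Fs (λ e → ∑ Fs (λ e′ → if adj e e′ ∧ lt e e′ then E ⁅ e ⁆∪⁅ e′ ⁆ else 0ℚ))
    P = ∑ Fs (λ e → ∑ Fs (B e))
    X≤ : X ≤ ∑ Fs (λ e → d e * W e) + P
    X≤ = begin
      X                                           ≤⟨ ∑-mono Fs (λ e _ → ∑-mono Fs (λ e′ _ → pair-bound e e′)) ⟩
      ∑ Fs (λ e → ∑ Fs (λ e′ → A e e′ + B e e′))   ≡⟨ trans (∑-cong Fs (λ e _ → ∑-+ Fs (A e) (B e))) (∑-+ Fs _ _) ⟩
      ∑ Fs (λ e → ∑ Fs (A e)) + P                 ≡⟨ cong (_+ P) ∑-adjacent-pairs ⟩
      ∑ Fs (λ e → d e * W e) + P                  ∎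
    single≤ : ∀ e → W e + d e * W e ≤ fromℕ κ * W e
    single≤ e = begin
      W e + d e * W e                               ≡⟨ solve 2 (λ w d → w :+ d :* w := (con 1ℚ :+ d) :* w) refl (W e) (d e) ⟩
      fromℕ (suc (degreeᵉ e ℕ.+ degreeᵉ e)) * W e   ≤⟨ *-monoʳ-≤-nonneg (W-nonneg e) (fromℕ-mono 1+2·degree≤κ) ⟩
      fromℕ κ * W e                                 ∎
      where
      1+2·degree≤κ : suc (degreeᵉ e ℕ.+ degreeᵉ e) ℕ.≤ κ
      1+2·degree≤κ = s≤s (ℕP.+-mono-≤ (count-adjᵇ≤ T e) (count-adjᵇ≤ T e))
    P≤κP : P ≤ fromℕ κ * P
    P≤κP = ℚP.≤-trans (ℚP.≤-reflexive (sym (ℚP.*-identityˡ P))) (*-monoʳ-≤-nonneg P≥0 (fromℕ-mono {1} {κ} (s≤s z≤n)))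
      where
      P≥0 : 0ℚ ≤ P
      P≥0 = ∑-nonneg Fs (λ e _ → ∑-nonneg Fs (λ e′ _ → if-nonneg (H e ∧ H e′ ∧ adj e e′ ∧ lt e e′) (E-nonneg _)))

module ConditionalVariances {n q : ℕ} (inE : Fin n → Bool) (adj : Fin n → Fin n → Bool) (f : Colouring n q → ℚ) where

  ΩE : List (Colouring n q)
  ΩE = Ω q inE adj

  E : (Fin n → Bool) → ℚ
  E S = Exp {n} {q} inE adj (VarS {n} {q} inE adj S f)

  E-nonneg : ∀ S → 0ℚ ≤ E S
  E-nonneg S = avg-nonneg ΩE (λ x _ → variance-nonneg (filterᵇ (agreeOutsideᵇ S x) ΩE) f)

  E≤Var : ∀ S → E S ≤ Var {n} {q} inE adj f
  E≤Var S = Conditioning.avg-condVar≤variance ΩE (agreeOutsideᵇ-isEquivalence S) f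

  E-local : ∀ S S′ → (∀ e → inE e ≡ true → S e ≡ S′ e) → E S ≡ E S′
  E-local S S′ S≡S′ =
    avg-cong ΩE (λ x x∈ → cong (λ K → variance (map f K)) (filterᵇ-cong ΩE (λ y y∈ → same-classes x∈ y∈)))
    where
    same-classes : ∀ {x y} → x ∈ ΩE → y ∈ ΩE → agreeOutsideᵇ S x y ≡ agreeOutsideᵇ S′ x y
    same-classes {x} {y} x∈ y∈ = allᵇ-cong (allFin n) (λ e _ → at e)
      where
      at : ∀ e → S e ∨ eqColᵇ (x e) (y e) ≡ S′ e ∨ eqColᵇ (x e) (y e)
      at e with inE e in ine
      ... | true  = cong (_∨ eqColᵇ (x e) (y e)) (S≡S′ e ine)
      ... | false rewrite options-nothing inE e ine (proj₁ (∈Ω⁻ inE adj x∈) e)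
                        | options-nothing inE e ine (proj₁ (∈Ω⁻ inE adj y∈) e)
                        = trans (BoolP.∨-zeroʳ (S e)) (sym (BoolP.∨-zeroʳ (S′ e)))

  E-∅ : E (λ _ → false) ≡ 0ℚ
  E-∅ = trans (avg-cong ΩE (λ x x∈ → trans (cong (λ K → variance (map f K)) (class-of x∈)) (variance-single (f x))))
              (avg-zero ΩE)
    where
    variance-single : ∀ y → variance (y ∷ []) ≡ 0ℚ
    variance-single = solve 1 (λ y → ((y :- (y :+ con 0ℚ) :* con 1ℚ) :* (y :- (y :+ con 0ℚ) :* con 1ℚ) :+ con 0ℚ) :* con 1ℚ
                                     := con 0ℚ) refl
    class-of : ∀ {x} → x ∈ ΩE → filterᵇ (agreeOutsideᵇ (λ _ → false) x) ΩE ≡ x ∷ []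
    class-of {x} x∈ with ∈Ω⁻ inE adj x∈
    ... | x∈options , proper = filterᵇ-unique ΩE (agreeOutsideᵇ (λ _ → false) x)
      (trans (count-cong ΩE (λ y _ → agreeOutsideᵇ-sym (λ _ → false) x y))
             (count-Ω-pointwise inE adj x x∈options proper))
      x∈ (IsEquivalence.refl (agreeOutsideᵇ-isEquivalence {q} {n} (λ _ → false)) {x})

open import Data.Integer using (+_)
import Data.Nat

lemma3p16 : ∀ (n : ℕ) (T : RootedTree n) (H : Fin n → Bool) (q : ℕ) (C : ℚ)
    → RootedSubtree T H
    → suc (maxDegree T) Data.Nat.≤ q
    → EdgeTensorization {n} {q} allEdges (adjᵇ T) C
    → EdgeTensorization {n} {q} H (adjᵇ T) (C * ((+ ((suc q) Data.Nat.* (suc q))) / 1))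
lemma3p16 n T H q C closed Δ<q tensorised f = subst (λ k → V ≤ (C * k) * B) (fromℕ≡/1 (suc q ℕ.* suc q))
  (scaled-bound {C = C} {k = fromℕ (suc q ℕ.* suc q)} A≥0 B≥0 V≤CA A≤kB V≤0⇒B≤0)
  where
  open Restriction T q H closed Δ<q
  module μ = ConditionalVariances allEdges (adjᵇ T) (f ∘ restrict)
  module ν = ConditionalVariances H (adjᵇ T) f
  open LocalisedSums q T H ν.E ν.E-nonneg ν.E-local ν.E-∅ using (κ; ∑𝒫-bound)
  𝒫T 𝒫H : List (Fin n → Bool)
  𝒫T = 𝒫 {n} {q} allEdges (adjᵇ T)
  𝒫H = 𝒫 {n} {q} H (adjᵇ T)
  V A B : ℚ
  V = Var {n} {q} H (adjᵇ T) f
  A = ∑ 𝒫T μ.E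
  B = ∑ 𝒫H ν.E
  A≥0 : 0ℚ ≤ A
  A≥0 = ∑-nonneg 𝒫T (λ S _ → μ.E-nonneg S)
  B≥0 : 0ℚ ≤ B
  B≥0 = ∑-nonneg 𝒫H (λ S _ → ν.E-nonneg S)
  V≤CA : V ≤ C * A
  V≤CA = subst (_≤ C * A) (variance-restrict f) (tensorised (f ∘ restrict))
  A≤kB : A ≤ fromℕ (suc q ℕ.* suc q) * B
  A≤kB = begin
    ∑ 𝒫T μ.E                     ≤⟨ ∑-mono 𝒫T (λ S _ → condVar-restrict≤ S f) ⟩
    ∑ 𝒫T ν.E                     ≤⟨ ∑𝒫-bound ⟩
    fromℕ κ * B                  ≤⟨ *-monoʳ-≤-nonneg B≥0 (fromℕ-mono (1+4Δ≤[1+q]² Δ<q)) ⟩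
    fromℕ (suc q ℕ.* suc q) * B  ∎
    where open ℚP.≤-Reasoning
  V≤0⇒B≤0 : V ≤ 0ℚ → B ≤ 0ℚ
  V≤0⇒B≤0 V≤0 = ℚP.≤-trans (∑-mono 𝒫H (λ S _ → ℚP.≤-trans (ν.E≤Var S) V≤0)) (ℚP.≤-reflexive (∑-zero 𝒫H))
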